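{- Let $H$ be a triangle-free graph on $k$ vertices. Then $H$ has at most $e^2\left(\frac{k}{2e}\right)^k$ Hamiltonian cycles.
   Context: Graphs are finite and simple. A Hamiltonian cycle of $H$ is a cycle (subgraph isomorphic to $C_m$, $m\geq 3$) passing through every vertex of $H$. A graph is triangle-free if it contains no cycle of length $3$. $e$ is the base of the natural logarithm. -}

module Defs where

open import Data.Nat using (ℕ; zero; suc; _∸_; _!)
open import Data.Nat.Properties using (_!≢0)
open import Data.Fin using (Fin; toℕ)
open import Data.Bool using (Bool; true; false)
open import Data.Product using (Σ; ∃; _×_; _,_)
open import Data.Sum using (_⊎_)
open import Data.List using (List; length)
open import Data.List.Relation.Unary.AllPairs using (AllPairs)
open import Data.Integer using (+_)
open import Data.Rational using (ℚ; 0ℚ; 1ℚ; _+_; _*_; _/_)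
open import Relation.Binary.PropositionalEquality using (_≡_; _≢_)
open import Relation.Nullary using (¬_)
open import Function using (Injective)

record Graph (k : ℕ) : Set where
  field
    adj     : Fin k → Fin k → Bool
    symm    : ∀ u v → adj u v ≡ adj v u
    irrefl  : ∀ u → adj u u ≡ false
open Graph public

-- No cycle of length 3 (simple graph: three pairwise adjacent vertices
-- are automatically distinct, by irreflexivity).
TriangleFree : ∀ {k} → Graph k → Set
TriangleFree {k} G =
  ¬ (Σ (Fin k) λ u → Σ (Fin k) λ v → Σ (Fin k) λ w →
       (adj G u v ≡ true) × (adj G v w ≡ true) × (adj G u w ≡ true))

EdgeSet : ℕ → Set
EdgeSet k = Fin k → Fin k → Bool

CycNext : ∀ {k} → Fin k → Fin k → Set
CycNext {k} i j = (toℕ j ≡ suc (toℕ i)) ⊎ ((toℕ i ≡ k ∸ 1) × (toℕ j ≡ 0))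

CycleEdge : ∀ {k} → (Fin k → Fin k) → Fin k → Fin k → Set
CycleEdge {k} σ u v =
  Σ (Fin k) λ i → Σ (Fin k) λ j → CycNext i j ×
    (((u ≡ σ i) × (v ≡ σ j)) ⊎ ((u ≡ σ j) × (v ≡ σ i)))

HamCycle : ∀ {k} → Graph k → EdgeSet k → Set
HamCycle {k} G C =
  (3 Data.Nat.≤ k) ×
  (∀ u v → C u v ≡ true → adj G u v ≡ true) ×
  (Σ (Fin k → Fin k) λ σ → Injective _≡_ _≡_ σ ×
     (∀ u v → (C u v ≡ true → CycleEdge σ u v) × (CycleEdge σ u v → C u v ≡ true)))

DistinctES : ∀ {k} → EdgeSet k → EdgeSet k → Set
DistinctES {k} C D = Σ (Fin k) λ u → Σ (Fin k) λ v → C u v ≢ D u v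

-- "H has at most N Hamiltonian cycles" for N : ℕ is expressed as: every list of
-- pairwise distinct Hamiltonian cycles has length ≤ N.
-- Rational powers.
_^ℚ_ : ℚ → ℕ → ℚ
q ^ℚ zero = 1ℚ
q ^ℚ suc n = q * (q ^ℚ n)

-- Partial sums of the exponential series: eSum n = Σ_{i=0}^{n} 1/i!, increasing to e.
eSum : ℕ → ℚ
eSum zero = 1ℚ
eSum (suc n) = eSum n + ((+ 1) / (suc n !)) {{suc n !≢0}}

ℕ→ℚ : ℕ → ℚ
ℕ→ℚ n = (+ n) / 1

module Submission where

-- Listing a Hamiltonian cycle of a graph on k vertices from vertex 0 gives a path 0, w₁, …, w_{k-1}
-- through all vertices, and distinct cycles give distinct paths. Suppose the walk is at v with m
-- unvisited vertices, c of them adjacent to v. After stepping to one of them, w, the unvisited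
-- neighbours of w avoid those c vertices (a common neighbour of v and w would close a triangle), so
-- two consecutive steps offer at most c (m - c) ≤ ⌈m/2⌉ ⌊m/2⌋ choices, and there are at most
-- ⌈(k-1)/2⌉! ⌊(k-1)/2⌋! paths.
--
-- It remains to show ⌈(k-1)/2⌉! ⌊(k-1)/2⌋! 2ᵏ sᵏ ≤ kᵏ s² for every partial sum s of the series of e,
-- which follows by telescoping (1 + 1/j)^(2j+1) ≥ s² and (1 + 1/j)^(j+1) ≥ s. Let E be a truncation of
-- the exponential series. The binomial theorem makes E supermultiplicative, so s = E(1) ≤ E(1/N)^N;
-- bounding the tail of E(x) by a geometric series gives E(x)² (1 - x) ≤ 1 + x, a truncated form of
-- e^(2x) ≤ (1 + x)/(1 - x), and E(x) (1 - x) ≤ 1. Take x = 1/N with N = 2j+1, resp. N = j+1.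

open import Defs

module Analysis where

  open import Data.Nat.Base as ℕ using (ℕ; zero; suc; _∸_; _!; NonZero)
  import Data.Nat.Properties as ℕ
  open import Data.Nat.Tactic.RingSolver using (solve-∀)
  open import Data.Integer.Base as ℤ using ()
  import Data.Integer.Properties as ℤ
  open import Data.Rational.Base as ℚ
    using (ℚ; 0ℚ; 1ℚ; _+_; _*_; _-_; _≤_; _<_; _/_; toℚᵘ; nonNegative; positive)
  import Data.Rational.Properties as ℚ
  open import Data.Rational.Unnormalised.Base as ℚᵘ using (mkℚᵘ; *≡*)
  import Data.Rational.Unnormalised.Properties as ℚᵘ
  open import Data.Rational.Solver using (module +-*-Solver)
  open import Data.Product.Base using (_,_)
  open import Relation.Binary.PropositionalEquality
  open +-*-Solver using (solve; _:=_; _:+_; _:-_; _:*_; con)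

  1/ℕ : (n : ℕ) .{{_ : NonZero n}} → ℚ
  1/ℕ n = ℤ.+ 1 / n

  toℚᵘ-/ : ∀ n d .{{_ : NonZero d}} → toℚᵘ (ℤ.+ n / d) ℚᵘ.≃ mkℚᵘ (ℤ.+ n) (ℕ.pred d)
  toℚᵘ-/ n (suc d) = ℚ.toℚᵘ-fromℚᵘ (mkℚᵘ (ℤ.+ n) d)

  ℕ→ℚ-homo-+ : ∀ m n → ℕ→ℚ (m ℕ.+ n) ≡ ℕ→ℚ m + ℕ→ℚ n
  ℕ→ℚ-homo-+ m n = ℚ.toℚᵘ-injective (begin
    toℚᵘ (ℕ→ℚ (m ℕ.+ n))               ≈⟨ toℚᵘ-/ (m ℕ.+ n) 1 ⟩
    mkℚᵘ (ℤ.+ (m ℕ.+ n)) 0              ≈⟨ *≡* (cong (ℤ._* ℤ.+ 1) (sym (cong₂ ℤ._+_ (ℤ.*-identityʳ (ℤ.+ m)) (ℤ.*-identityʳ (ℤ.+ n))))) ⟩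
    mkℚᵘ (ℤ.+ m) 0 ℚᵘ.+ mkℚᵘ (ℤ.+ n) 0  ≈⟨ ℚᵘ.+-cong (toℚᵘ-/ m 1) (toℚᵘ-/ n 1) ⟨
    toℚᵘ (ℕ→ℚ m) ℚᵘ.+ toℚᵘ (ℕ→ℚ n)     ≈⟨ ℚ.toℚᵘ-homo-+ (ℕ→ℚ m) (ℕ→ℚ n) ⟨
    toℚᵘ (ℕ→ℚ m + ℕ→ℚ n)               ∎)
    where open ℚᵘ.≃-Reasoning

  ℕ→ℚ-homo-* : ∀ m n → ℕ→ℚ (m ℕ.* n) ≡ ℕ→ℚ m * ℕ→ℚ n
  ℕ→ℚ-homo-* m n = ℚ.toℚᵘ-injective (begin
    toℚᵘ (ℕ→ℚ (m ℕ.* n))               ≈⟨ toℚᵘ-/ (m ℕ.* n) 1 ⟩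
    mkℚᵘ (ℤ.+ (m ℕ.* n)) 0              ≈⟨ *≡* (cong (ℤ._* ℤ.+ 1) (ℤ.pos-* m n)) ⟩
    mkℚᵘ (ℤ.+ m) 0 ℚᵘ.* mkℚᵘ (ℤ.+ n) 0  ≈⟨ ℚᵘ.*-cong (toℚᵘ-/ m 1) (toℚᵘ-/ n 1) ⟨
    toℚᵘ (ℕ→ℚ m) ℚᵘ.* toℚᵘ (ℕ→ℚ n)     ≈⟨ ℚ.toℚᵘ-homo-* (ℕ→ℚ m) (ℕ→ℚ n) ⟨
    toℚᵘ (ℕ→ℚ m * ℕ→ℚ n)               ∎)
    where open ℚᵘ.≃-Reasoning

  ℕ→ℚ-homo-^ : ∀ m n → ℕ→ℚ (m ℕ.^ n) ≡ ℕ→ℚ m ^ℚ n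
  ℕ→ℚ-homo-^ m zero    = refl
  ℕ→ℚ-homo-^ m (suc n) = trans (ℕ→ℚ-homo-* m (m ℕ.^ n)) (cong (ℕ→ℚ m *_) (ℕ→ℚ-homo-^ m n))

  ℕ→ℚ-*-1/ℕ : ∀ m n .{{_ : NonZero n}} .{{_ : NonZero (m ℕ.* n)}} → ℕ→ℚ m * 1/ℕ (m ℕ.* n) ≡ 1/ℕ n
  ℕ→ℚ-*-1/ℕ m@(suc m-1) n@(suc n-1) = ℚ.toℚᵘ-injective (begin
    toℚᵘ (ℕ→ℚ m * 1/ℕ (m ℕ.* n))                          ≈⟨ ℚ.toℚᵘ-homo-* (ℕ→ℚ m) (1/ℕ (m ℕ.* n)) ⟩
    toℚᵘ (ℕ→ℚ m) ℚᵘ.* toℚᵘ (1/ℕ (m ℕ.* n))                ≈⟨ ℚᵘ.*-cong (toℚᵘ-/ m 1) (toℚᵘ-/ 1 (m ℕ.* n)) ⟩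
    mkℚᵘ (ℤ.+ m) 0 ℚᵘ.* mkℚᵘ (ℤ.+ 1) (ℕ.pred (m ℕ.* n))  ≈⟨ *≡* (cong ℤ.+_ (cross-multiplied m-1 n-1)) ⟩
    mkℚᵘ (ℤ.+ 1) n-1                                      ≈⟨ toℚᵘ-/ 1 n ⟨
    toℚᵘ (1/ℕ n)                                          ∎)
    where
    open ℚᵘ.≃-Reasoning
    -- The cross-multiplied ℚᵘ equation, in the form Agda normalises it to.
    cross-multiplied : ∀ a b → suc a ℕ.* 1 ℕ.* suc b ≡ 1 ℕ.* suc ((b ℕ.+ a ℕ.* suc b) ℕ.+ 0)
    cross-multiplied = solve-∀

  ℕ→ℚ-inverseʳ : ∀ n .{{_ : NonZero n}} → ℕ→ℚ n * 1/ℕ n ≡ 1ℚ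
  ℕ→ℚ-inverseʳ n@(suc n-1) =
    trans (cong (λ d → ℕ→ℚ n * 1/ℕ (suc d)) (sym (ℕ.*-identityʳ n-1))) (ℕ→ℚ-*-1/ℕ n 1)

  ℕ→ℚ-*-1-1/ℕ : ∀ n → ℕ→ℚ (suc n) * (1ℚ - 1/ℕ (suc n)) ≡ ℕ→ℚ n
  ℕ→ℚ-*-1-1/ℕ n = begin
    ℕ→ℚ (suc n) * (1ℚ - 1/ℕ (suc n))         ≡⟨ solve 2 (λ m x → m :* (con 1ℚ :- x) := m :- m :* x) refl (ℕ→ℚ (suc n)) (1/ℕ (suc n)) ⟩
    ℕ→ℚ (suc n) - ℕ→ℚ (suc n) * 1/ℕ (suc n)  ≡⟨ cong₂ _-_ (ℕ→ℚ-homo-+ 1 n) (ℕ→ℚ-inverseʳ (suc n)) ⟩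
    1ℚ + ℕ→ℚ n - 1ℚ                          ≡⟨ solve 1 (λ m → con 1ℚ :+ m :- con 1ℚ := m) refl (ℕ→ℚ n) ⟩
    ℕ→ℚ n                                    ∎
    where open ≡-Reasoning

  ℕ→ℚ-*-1+1/ℕ : ∀ n → ℕ→ℚ (suc n) * (1ℚ + 1/ℕ (suc n)) ≡ ℕ→ℚ (suc (suc n))
  ℕ→ℚ-*-1+1/ℕ n = begin
    ℕ→ℚ (suc n) * (1ℚ + 1/ℕ (suc n))              ≡⟨ ℚ.*-distribˡ-+ (ℕ→ℚ (suc n)) 1ℚ (1/ℕ (suc n)) ⟩
    ℕ→ℚ (suc n) * 1ℚ + ℕ→ℚ (suc n) * 1/ℕ (suc n)  ≡⟨ cong₂ _+_ (ℚ.*-identityʳ (ℕ→ℚ (suc n))) (ℕ→ℚ-inverseʳ (suc n)) ⟩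
    ℕ→ℚ (suc n) + 1ℚ                              ≡⟨ ℚ.+-comm (ℕ→ℚ (suc n)) 1ℚ ⟩
    1ℚ + ℕ→ℚ (suc n)                              ≡⟨ ℕ→ℚ-homo-+ 1 (suc n) ⟨
    ℕ→ℚ (suc (suc n))                             ∎
    where open ≡-Reasoning

  p≤p+q : ∀ {p q} → 0ℚ ≤ q → p ≤ p + q
  p≤p+q {p} 0≤q = ℚ.≤-trans (ℚ.≤-reflexive (sym (ℚ.+-identityʳ p))) (ℚ.+-monoʳ-≤ p 0≤q)

  p≤q⇒0≤q-p : ∀ {p q} → p ≤ q → 0ℚ ≤ q - p
  p≤q⇒0≤q-p {p} p≤q = ℚ.≤-trans (ℚ.≤-reflexive (sym (ℚ.+-inverseʳ p))) (ℚ.+-monoˡ-≤ (ℚ.- p) p≤q)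

  module _ {p q : ℚ} where

    *-nonNeg : 0ℚ ≤ p → 0ℚ ≤ q → 0ℚ ≤ p * q
    *-nonNeg 0≤p 0≤q = ℚ.nonNegative⁻¹ _ {{ℚ.nonNeg*nonNeg⇒nonNeg p {{nonNegative 0≤p}} q {{nonNegative 0≤q}}}}

    *-monoˡ-≤ : ∀ r → 0ℚ ≤ r → p ≤ q → r * p ≤ r * q
    *-monoˡ-≤ r 0≤r = ℚ.*-monoˡ-≤-nonNeg r {{nonNegative 0≤r}}

    *-monoʳ-≤ : ∀ r → 0ℚ ≤ r → p ≤ q → p * r ≤ q * r
    *-monoʳ-≤ r 0≤r = ℚ.*-monoʳ-≤-nonNeg r {{nonNegative 0≤r}}

    *-cancelˡ-≤ : ∀ r → 0ℚ < r → r * p ≤ r * q → p ≤ q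
    *-cancelˡ-≤ r 0<r = ℚ.*-cancelˡ-≤-pos r {{positive 0<r}}

  *-mono-≤ : ∀ {p q r s} → 0ℚ ≤ q → 0ℚ ≤ r → p ≤ q → r ≤ s → p * r ≤ q * s
  *-mono-≤ {q = q} {r} 0≤q 0≤r p≤q r≤s = ℚ.≤-trans (*-monoʳ-≤ r 0≤r p≤q) (*-monoˡ-≤ q 0≤q r≤s)

  ℕ→ℚ-nonNeg : ∀ n → 0ℚ ≤ ℕ→ℚ n
  ℕ→ℚ-nonNeg n = ℚ.nonNegative⁻¹ (ℕ→ℚ n) {{ℚ.normalize-nonNeg n 1}}

  ℕ→ℚ-pos : ∀ n → 0ℚ < ℕ→ℚ (suc n)
  ℕ→ℚ-pos n = ℚ.positive⁻¹ (ℕ→ℚ (suc n)) {{ℚ.normalize-pos (suc n) 1}}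

  ℕ→ℚ-mono-≤ : ∀ {m n} → m ℕ.≤ n → ℕ→ℚ m ≤ ℕ→ℚ n
  ℕ→ℚ-mono-≤ {m} m≤n with d , refl ← ℕ.m≤n⇒∃[o]m+o≡n m≤n =
    ℚ.≤-trans (p≤p+q (ℕ→ℚ-nonNeg d)) (ℚ.≤-reflexive (sym (ℕ→ℚ-homo-+ m d)))

  ℕ→ℚ-suc-*-cancelˡ : ∀ n {p q} → ℕ→ℚ (suc n) * p ≡ ℕ→ℚ (suc n) * q → p ≡ q
  ℕ→ℚ-suc-*-cancelˡ n eq = ℚ.≤-antisym
    (*-cancelˡ-≤ (ℕ→ℚ (suc n)) (ℕ→ℚ-pos n) (ℚ.≤-reflexive eq))
    (*-cancelˡ-≤ (ℕ→ℚ (suc n)) (ℕ→ℚ-pos n) (ℚ.≤-reflexive (sym eq)))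

  1/ℕ-nonNeg : ∀ n .{{_ : NonZero n}} → 0ℚ ≤ 1/ℕ n
  1/ℕ-nonNeg n = ℚ.nonNegative⁻¹ (1/ℕ n) {{ℚ.normalize-nonNeg 1 n}}

  1/ℕ-≤-1 : ∀ n → 1/ℕ (suc n) ≤ 1ℚ
  1/ℕ-≤-1 n = begin
    1/ℕ (suc n)                ≡⟨ ℚ.*-identityˡ (1/ℕ (suc n)) ⟨
    1ℚ * 1/ℕ (suc n)           ≤⟨ *-monoʳ-≤ (1/ℕ (suc n)) (1/ℕ-nonNeg (suc n)) (ℕ→ℚ-mono-≤ {1} {suc n} (ℕ.s≤s ℕ.z≤n)) ⟩
    ℕ→ℚ (suc n) * 1/ℕ (suc n)  ≡⟨ ℕ→ℚ-inverseʳ (suc n) ⟩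
    1ℚ                         ∎
    where open ℚ.≤-Reasoning

  ^ℚ-nonNeg : ∀ {p} n → 0ℚ ≤ p → 0ℚ ≤ p ^ℚ n
  ^ℚ-nonNeg zero    0≤p = ℚ.nonNegative⁻¹ 1ℚ
  ^ℚ-nonNeg (suc n) 0≤p = *-nonNeg 0≤p (^ℚ-nonNeg n 0≤p)

  ^ℚ-monoˡ-≤ : ∀ {p q} n → 0ℚ ≤ p → p ≤ q → p ^ℚ n ≤ q ^ℚ n
  ^ℚ-monoˡ-≤ zero    0≤p p≤q = ℚ.≤-refl
  ^ℚ-monoˡ-≤ (suc n) 0≤p p≤q = *-mono-≤ (ℚ.≤-trans 0≤p p≤q) (^ℚ-nonNeg n 0≤p) p≤q (^ℚ-monoˡ-≤ n 0≤p p≤q)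

  ^ℚ-distribʳ-* : ∀ p q n → (p * q) ^ℚ n ≡ p ^ℚ n * q ^ℚ n
  ^ℚ-distribʳ-* p q zero    = refl
  ^ℚ-distribʳ-* p q (suc n) = begin
    p * q * (p * q) ^ℚ n       ≡⟨ cong (p * q *_) (^ℚ-distribʳ-* p q n) ⟩
    p * q * (p ^ℚ n * q ^ℚ n)  ≡⟨ solve 4 (λ p q x y → p :* q :* (x :* y) := p :* x :* (q :* y)) refl p q (p ^ℚ n) (q ^ℚ n) ⟩
    p * p ^ℚ n * (q * q ^ℚ n)  ∎
    where open ≡-Reasoning

  ^ℚ-suc-+-suc : ∀ p m → p ^ℚ (suc m ℕ.+ suc m) ≡ p * (p * p ^ℚ (m ℕ.+ m))
  ^ℚ-suc-+-suc p m = cong (λ e → p * p ^ℚ e) (ℕ.+-suc m m)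

  ∑ : ℕ → (ℕ → ℚ) → ℚ
  ∑ zero    f = 0ℚ
  ∑ (suc n) f = ∑ n f + f n

  syntax ∑ n (λ i → x) = ∑[ i < n ] x

  module _ {f g : ℕ → ℚ} where

    ∑-cong : ∀ n → (∀ i → i ℕ.< n → f i ≡ g i) → ∑ n f ≡ ∑ n g
    ∑-cong zero    f≡g = refl
    ∑-cong (suc n) f≡g = cong₂ _+_ (∑-cong n (λ i i<n → f≡g i (ℕ.m<n⇒m<1+n i<n))) (f≡g n ℕ.≤-refl)

    ∑-mono-≤ : ∀ n → (∀ i → i ℕ.< n → f i ≤ g i) → ∑ n f ≤ ∑ n g
    ∑-mono-≤ zero    f≤g = ℚ.≤-refl
    ∑-mono-≤ (suc n) f≤g = ℚ.+-mono-≤ (∑-mono-≤ n (λ i i<n → f≤g i (ℕ.m<n⇒m<1+n i<n))) (f≤g n ℕ.≤-refl)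

    ∑-distrib-+ : ∀ n → ∑[ i < n ] (f i + g i) ≡ ∑ n f + ∑ n g
    ∑-distrib-+ zero    = refl
    ∑-distrib-+ (suc n) = trans (cong (_+ (f n + g n)) (∑-distrib-+ n))
      (solve 4 (λ a b c d → (a :+ b) :+ (c :+ d) := (a :+ c) :+ (b :+ d)) refl (∑ n f) (∑ n g) (f n) (g n))

  ∑-nonNeg : ∀ {f} n → (∀ i → 0ℚ ≤ f i) → 0ℚ ≤ ∑ n f
  ∑-nonNeg zero    0≤f = ℚ.≤-refl
  ∑-nonNeg (suc n) 0≤f = ℚ.+-mono-≤ (∑-nonNeg n 0≤f) (0≤f n)

  *-distribˡ-∑ : ∀ c f n → c * ∑ n f ≡ ∑[ i < n ] (c * f i)
  *-distribˡ-∑ c f zero    = ℚ.*-zeroʳ c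
  *-distribˡ-∑ c f (suc n) = trans (ℚ.*-distribˡ-+ c (∑ n f) (f n)) (cong (_+ c * f n) (*-distribˡ-∑ c f n))

  ∑-suc : ∀ f n → ∑ (suc n) f ≡ f 0 + ∑[ i < n ] (f (suc i))
  ∑-suc f zero    = trans (ℚ.+-identityˡ (f 0)) (sym (ℚ.+-identityʳ (f 0)))
  ∑-suc f (suc n) = trans (cong (_+ f (suc n)) (∑-suc f n)) (ℚ.+-assoc (f 0) _ _)

  -- Truncations of the exponential series

  term : ℕ → ℚ → ℚ
  term t z = z ^ℚ t * 1/ℕ (t !) {{t ℕ.!≢0}}

  expSum : ℕ → ℚ → ℚ
  expSum n z = ∑[ t < suc n ] (term t z)

  term-nonNeg : ∀ t {z} → 0ℚ ≤ z → 0ℚ ≤ term t z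
  term-nonNeg t 0≤z = *-nonNeg (^ℚ-nonNeg t 0≤z) (1/ℕ-nonNeg (t !) {{t ℕ.!≢0}})

  expSum-nonNeg : ∀ n {z} → 0ℚ ≤ z → 0ℚ ≤ expSum n z
  expSum-nonNeg n 0≤z = ∑-nonNeg (suc n) (λ t → term-nonNeg t 0≤z)

  term-suc : ∀ t z → ℕ→ℚ (suc t) * term (suc t) z ≡ z * term t z
  term-suc t z = begin
    ℕ→ℚ (suc t) * (z * z ^ℚ t * r)        ≡⟨ solve 4 (λ m z x r → m :* (z :* x :* r) := z :* x :* (m :* r)) refl (ℕ→ℚ (suc t)) z (z ^ℚ t) r ⟩
    z * z ^ℚ t * (ℕ→ℚ (suc t) * r)        ≡⟨ cong (z * z ^ℚ t *_) (ℕ→ℚ-*-1/ℕ (suc t) (t !) {{t ℕ.!≢0}} {{suc t ℕ.!≢0}}) ⟩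
    z * z ^ℚ t * 1/ℕ (t !) {{t ℕ.!≢0}}    ≡⟨ ℚ.*-assoc z (z ^ℚ t) _ ⟩
    z * term t z                          ∎
    where
    open ≡-Reasoning
    r = 1/ℕ (suc t !) {{suc t ℕ.!≢0}}

  expSum-mono-≤ : ∀ {z} → 0ℚ ≤ z → ∀ {m n} → m ℕ.≤ n → expSum m z ≤ expSum n z
  expSum-mono-≤ 0≤z m≤n with ℕ.≤⇒≤′ m≤n
  ... | ℕ.≤′-refl                  = ℚ.≤-refl
  ... | ℕ.≤′-step {n = n-1} m≤′n-1 =
    ℚ.≤-trans (expSum-mono-≤ 0≤z (ℕ.≤′⇒≤ m≤′n-1)) (p≤p+q (term-nonNeg (suc n-1) 0≤z))

  eSum≡expSum : ∀ n → eSum n ≡ expSum n 1ℚ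
  eSum≡expSum zero    = refl
  eSum≡expSum (suc n) = cong₂ _+_ (eSum≡expSum n) (sym (term-one (suc n)))
    where
    1^ℚ : ∀ t → 1ℚ ^ℚ t ≡ 1ℚ
    1^ℚ zero    = refl
    1^ℚ (suc t) = trans (ℚ.*-identityˡ (1ℚ ^ℚ t)) (1^ℚ t)
    term-one : ∀ t → term t 1ℚ ≡ 1/ℕ (t !) {{t ℕ.!≢0}}
    term-one t = trans (cong (_* 1/ℕ (t !) {{t ℕ.!≢0}}) (1^ℚ t)) (ℚ.*-identityˡ _)

  eSum-nonNeg : ∀ n → 0ℚ ≤ eSum n
  eSum-nonNeg n = subst (0ℚ ≤_) (sym (eSum≡expSum n)) (expSum-nonNeg n (ℚ.nonNegative⁻¹ 1ℚ))

  cauchyTerm : ℕ → ℚ → ℚ → ℚ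
  cauchyTerm t a b = ∑[ i < suc t ] (term i a * term (t ∸ i) b)

  module _ (t : ℕ) (a b : ℚ) where

    cauchyTerm-weightˡ : ∑[ i < suc (suc t) ] (ℕ→ℚ i * term i a * term (suc t ∸ i) b) ≡ a * cauchyTerm t a b
    cauchyTerm-weightˡ = begin
      ∑[ i < suc (suc t) ] (w i)                          ≡⟨ ∑-suc w (suc t) ⟩
      w 0 + ∑[ i < suc t ] (w (suc i))                    ≡⟨ cong (_+ ∑[ i < suc t ] (w (suc i))) (ℚ.*-zeroˡ (term (suc t) b)) ⟩
      0ℚ + ∑[ i < suc t ] (w (suc i))                     ≡⟨ ℚ.+-identityˡ _ ⟩
      ∑[ i < suc t ] (w (suc i))                          ≡⟨ ∑-cong (suc t) (λ i _ → cong (_* term (t ∸ i) b) (term-suc i a)) ⟩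
      ∑[ i < suc t ] (a * term i a * term (t ∸ i) b)      ≡⟨ ∑-cong (suc t) (λ i _ → ℚ.*-assoc a (term i a) _) ⟩
      ∑[ i < suc t ] (a * (term i a * term (t ∸ i) b))    ≡⟨ *-distribˡ-∑ a _ (suc t) ⟨
      a * cauchyTerm t a b                                ∎
      where
      open ≡-Reasoning
      w : ℕ → ℚ
      w i = ℕ→ℚ i * term i a * term (suc t ∸ i) b

    cauchyTerm-weightʳ : ∑[ i < suc (suc t) ] (term i a * (ℕ→ℚ (suc t ∸ i) * term (suc t ∸ i) b)) ≡ b * cauchyTerm t a b
    cauchyTerm-weightʳ = begin
      ∑ (suc t) w + w (suc t)                             ≡⟨ cong₂ _+_ (∑-cong (suc t) w-init) w-last ⟩
      ∑[ i < suc t ] (b * (term i a * term (t ∸ i) b)) + 0ℚ ≡⟨ ℚ.+-identityʳ _ ⟩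
      ∑[ i < suc t ] (b * (term i a * term (t ∸ i) b))    ≡⟨ *-distribˡ-∑ b _ (suc t) ⟨
      b * cauchyTerm t a b                                ∎
      where
      open ≡-Reasoning
      w : ℕ → ℚ
      w i = term i a * (ℕ→ℚ (suc t ∸ i) * term (suc t ∸ i) b)
      w-last : w (suc t) ≡ 0ℚ
      w-last = begin
        term (suc t) a * (ℕ→ℚ (t ∸ t) * term (t ∸ t) b)  ≡⟨ cong (λ n → term (suc t) a * (ℕ→ℚ n * term n b)) (ℕ.n∸n≡0 t) ⟩
        term (suc t) a * (0ℚ * term 0 b)                 ≡⟨ cong (term (suc t) a *_) (ℚ.*-zeroˡ (term 0 b)) ⟩
        term (suc t) a * 0ℚ                              ≡⟨ ℚ.*-zeroʳ (term (suc t) a) ⟩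
        0ℚ                                               ∎
      w-init : ∀ i → i ℕ.< suc t → w i ≡ b * (term i a * term (t ∸ i) b)
      w-init i i<1+t = begin
        term i a * (ℕ→ℚ (suc t ∸ i) * term (suc t ∸ i) b)      ≡⟨ cong (λ n → term i a * (ℕ→ℚ n * term n b)) (ℕ.+-∸-assoc 1 (ℕ.≤-pred i<1+t)) ⟩
        term i a * (ℕ→ℚ (suc (t ∸ i)) * term (suc (t ∸ i)) b)  ≡⟨ cong (term i a *_) (term-suc (t ∸ i) b) ⟩
        term i a * (b * term (t ∸ i) b)                        ≡⟨ solve 3 (λ x y z → x :* (y :* z) := y :* (x :* z)) refl (term i a) b (term (t ∸ i) b) ⟩
        b * (term i a * term (t ∸ i) b)                        ∎

    cauchyTerm-suc : ℕ→ℚ (suc t) * cauchyTerm (suc t) a b ≡ (a + b) * cauchyTerm t a b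
    cauchyTerm-suc = begin
      ℕ→ℚ (suc t) * cauchyTerm (suc t) a b           ≡⟨ *-distribˡ-∑ (ℕ→ℚ (suc t)) g (suc (suc t)) ⟩
      ∑[ i < suc (suc t) ] (ℕ→ℚ (suc t) * g i)       ≡⟨ ∑-cong (suc (suc t)) split ⟩
      ∑[ i < suc (suc t) ] (wˡ i + wʳ i)             ≡⟨ ∑-distrib-+ (suc (suc t)) ⟩
      ∑ (suc (suc t)) wˡ + ∑ (suc (suc t)) wʳ        ≡⟨ cong₂ _+_ cauchyTerm-weightˡ cauchyTerm-weightʳ ⟩
      a * cauchyTerm t a b + b * cauchyTerm t a b    ≡⟨ ℚ.*-distribʳ-+ (cauchyTerm t a b) a b ⟨
      (a + b) * cauchyTerm t a b                     ∎
      where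
      open ≡-Reasoning
      g wˡ wʳ : ℕ → ℚ
      g  i = term i a * term (suc t ∸ i) b
      wˡ i = ℕ→ℚ i * term i a * term (suc t ∸ i) b
      wʳ i = term i a * (ℕ→ℚ (suc t ∸ i) * term (suc t ∸ i) b)
      split : ∀ i → i ℕ.< suc (suc t) → ℕ→ℚ (suc t) * g i ≡ wˡ i + wʳ i
      split i i<2+t = begin
        ℕ→ℚ (suc t) * g i                ≡⟨ cong (λ n → ℕ→ℚ n * g i) (ℕ.m+[n∸m]≡n (ℕ.≤-pred i<2+t)) ⟨
        ℕ→ℚ (i ℕ.+ (suc t ∸ i)) * g i    ≡⟨ cong (_* g i) (ℕ→ℚ-homo-+ i (suc t ∸ i)) ⟩
        (ℕ→ℚ i + ℕ→ℚ (suc t ∸ i)) * g i  ≡⟨ solve 4 (λ m n x y → (m :+ n) :* (x :* y) := m :* x :* y :+ x :* (n :* y)) refl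
                                              (ℕ→ℚ i) (ℕ→ℚ (suc t ∸ i)) (term i a) (term (suc t ∸ i) b) ⟩
        wˡ i + wʳ i                      ∎

  term-+ : ∀ t a b → term t (a + b) ≡ cauchyTerm t a b
  term-+ zero    a b = refl
  term-+ (suc t) a b = ℕ→ℚ-suc-*-cancelˡ t (begin
    ℕ→ℚ (suc t) * term (suc t) (a + b)    ≡⟨ term-suc t (a + b) ⟩
    (a + b) * term t (a + b)              ≡⟨ cong ((a + b) *_) (term-+ t a b) ⟩
    (a + b) * cauchyTerm t a b            ≡⟨ cauchyTerm-suc t a b ⟨
    ℕ→ℚ (suc t) * cauchyTerm (suc t) a b  ∎)
    where open ≡-Reasoning

  ∑term*expSum≡∑cauchyTerm : ∀ n a b → ∑[ i < suc n ] (term i a * expSum (n ∸ i) b) ≡ ∑[ t < suc n ] (cauchyTerm t a b)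
  ∑term*expSum≡∑cauchyTerm zero    a b = refl
  ∑term*expSum≡∑cauchyTerm (suc n) a b = begin
    ∑ (suc n) f + term (suc n) a * expSum (n ∸ n) b
      ≡⟨ cong₂ _+_ (∑-cong (suc n) split) (cong (term (suc n) a *_) expSum≡term) ⟩
    ∑[ i < suc n ] (term i a * expSum (n ∸ i) b + term i a * term (suc n ∸ i) b) + term (suc n) a * term (n ∸ n) b
      ≡⟨ cong (_+ term (suc n) a * term (n ∸ n) b) (∑-distrib-+ (suc n)) ⟩
    ∑[ i < suc n ] (term i a * expSum (n ∸ i) b) + ∑[ i < suc n ] (term i a * term (suc n ∸ i) b) + term (suc n) a * term (n ∸ n) b
      ≡⟨ ℚ.+-assoc (∑[ i < suc n ] (term i a * expSum (n ∸ i) b)) _ _ ⟩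
    ∑[ i < suc n ] (term i a * expSum (n ∸ i) b) + cauchyTerm (suc n) a b
      ≡⟨ cong (_+ cauchyTerm (suc n) a b) (∑term*expSum≡∑cauchyTerm n a b) ⟩
    ∑[ t < suc (suc n) ] (cauchyTerm t a b)
      ∎
    where
    open ≡-Reasoning
    f : ℕ → ℚ
    f i = term i a * expSum (suc n ∸ i) b
    expSum≡term : expSum (n ∸ n) b ≡ term (n ∸ n) b
    expSum≡term = subst (λ m → expSum m b ≡ term m b) (sym (ℕ.n∸n≡0 n)) refl
    split : ∀ i → i ℕ.< suc n → f i ≡ term i a * expSum (n ∸ i) b + term i a * term (suc n ∸ i) b
    split i i<1+n = begin
      term i a * expSum (suc n ∸ i) b                                ≡⟨ cong (λ m → term i a * expSum m b) 1+n∸i ⟩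
      term i a * expSum (suc (n ∸ i)) b                              ≡⟨ ℚ.*-distribˡ-+ (term i a) _ _ ⟩
      term i a * expSum (n ∸ i) b + term i a * term (suc (n ∸ i)) b  ≡⟨ cong (λ m → term i a * expSum (n ∸ i) b + term i a * term m b) 1+n∸i ⟨
      term i a * expSum (n ∸ i) b + term i a * term (suc n ∸ i) b    ∎
      where 1+n∸i = ℕ.+-∸-assoc 1 (ℕ.≤-pred i<1+n)

  expSum-+-≤ : ∀ n {a b} → 0ℚ ≤ a → 0ℚ ≤ b → expSum n (a + b) ≤ expSum n a * expSum n b
  expSum-+-≤ n {a} {b} 0≤a 0≤b = begin
    expSum n (a + b)                               ≡⟨ ∑-cong (suc n) (λ t _ → term-+ t a b) ⟩
    ∑[ t < suc n ] (cauchyTerm t a b)              ≡⟨ ∑term*expSum≡∑cauchyTerm n a b ⟨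
    ∑[ i < suc n ] (term i a * expSum (n ∸ i) b)   ≤⟨ ∑-mono-≤ (suc n) (λ i _ → *-monoˡ-≤ (term i a) (term-nonNeg i 0≤a) (expSum-mono-≤ 0≤b (ℕ.m∸n≤m n i))) ⟩
    ∑[ i < suc n ] (term i a * expSum n b)         ≡⟨ ∑-cong (suc n) (λ i _ → ℚ.*-comm (term i a) (expSum n b)) ⟩
    ∑[ i < suc n ] (expSum n b * term i a)         ≡⟨ *-distribˡ-∑ (expSum n b) _ (suc n) ⟨
    expSum n b * expSum n a                        ≡⟨ ℚ.*-comm (expSum n b) (expSum n a) ⟩
    expSum n a * expSum n b                        ∎
    where open ℚ.≤-Reasoning

  expSum-*-≤-^ : ∀ n K {x} → 0ℚ ≤ x → expSum n (ℕ→ℚ (suc K) * x) ≤ expSum n x ^ℚ suc K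
  expSum-*-≤-^ n zero    {x} 0≤x = ℚ.≤-reflexive (trans (cong (expSum n) (ℚ.*-identityˡ x)) (sym (ℚ.*-identityʳ _)))
  expSum-*-≤-^ n (suc K) {x} 0≤x = begin
    expSum n (ℕ→ℚ (2 ℕ.+ K) * x)             ≡⟨ cong (expSum n) [2+K]x≡x+[1+K]x ⟩
    expSum n (x + ℕ→ℚ (suc K) * x)           ≤⟨ expSum-+-≤ n 0≤x (*-nonNeg (ℕ→ℚ-nonNeg (suc K)) 0≤x) ⟩
    expSum n x * expSum n (ℕ→ℚ (suc K) * x)  ≤⟨ *-monoˡ-≤ (expSum n x) (expSum-nonNeg n 0≤x) (expSum-*-≤-^ n K 0≤x) ⟩
    expSum n x * expSum n x ^ℚ suc K         ∎
    where
    open ℚ.≤-Reasoning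
    [2+K]x≡x+[1+K]x : ℕ→ℚ (2 ℕ.+ K) * x ≡ x + ℕ→ℚ (suc K) * x
    [2+K]x≡x+[1+K]x = trans (cong (_* x) (ℕ→ℚ-homo-+ 1 (suc K)))
      (trans (ℚ.*-distribʳ-+ x 1ℚ (ℕ→ℚ (suc K))) (cong (_+ ℕ→ℚ (suc K) * x) (ℚ.*-identityˡ x)))

  eSum-≤-expSum^ : ∀ n N → eSum n ≤ expSum n (1/ℕ (suc N)) ^ℚ suc N
  eSum-≤-expSum^ n N = begin
    eSum n                                  ≡⟨ eSum≡expSum n ⟩
    expSum n 1ℚ                             ≡⟨ cong (expSum n) (ℕ→ℚ-inverseʳ (suc N)) ⟨
    expSum n (ℕ→ℚ (suc N) * 1/ℕ (suc N))    ≤⟨ expSum-*-≤-^ n N (1/ℕ-nonNeg (suc N)) ⟩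
    expSum n (1/ℕ (suc N)) ^ℚ suc N         ∎
    where open ℚ.≤-Reasoning

  ½ : ℚ
  ½ = 1/ℕ 2

  expSum-tail-≤ : ∀ n {x} → 0ℚ ≤ x → x ≤ ℕ→ℚ 3 →
                  (ℕ→ℚ 3 - x) * expSum n x ≤ ℕ→ℚ 3 + ℕ→ℚ 2 * x + ½ * (x * x)
  expSum-tail-≤ n {x} 0≤x x≤3 = begin
    c * expSum n x                                 ≤⟨ *-monoˡ-≤ c (p≤q⇒0≤q-p x≤3) (expSum-mono-≤ 0≤x (ℕ.m≤n+m n 2)) ⟩
    c * expSum (2 ℕ.+ n) x                         ≤⟨ p≤p+q (*-nonNeg 0≤x (term-nonNeg (2 ℕ.+ n) 0≤x)) ⟩
    c * expSum (2 ℕ.+ n) x + x * term (2 ℕ.+ n) x  ≤⟨ invariant n ⟩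
    V                                              ∎
    where
    open ℚ.≤-Reasoning
    c V : ℚ
    c = ℕ→ℚ 3 - x
    V = ℕ→ℚ 3 + ℕ→ℚ 2 * x + ½ * (x * x)
    -- From the third term on, each term is at most x/3 times the previous one.
    invariant : ∀ t → c * expSum (2 ℕ.+ t) x + x * term (2 ℕ.+ t) x ≤ V
    -- The left-hand side is written as expSum 2 x and term 2 x unfold.
    invariant zero = ℚ.≤-reflexive (solve 1 (λ x →
      (con (ℕ→ℚ 3) :- x) :* (((con 0ℚ :+ con 1ℚ) :+ x :* con 1ℚ :* con 1ℚ) :+ x :* (x :* con 1ℚ) :* con ½)
        :+ x :* (x :* (x :* con 1ℚ) :* con ½)
      := con (ℕ→ℚ 3) :+ con (ℕ→ℚ 2) :* x :+ con ½ :* (x :* x)) refl x)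
    invariant (suc t) = begin
      c * (S + T′) + x * T′         ≡⟨ solve 4 (λ c x S T′ → c :* (S :+ T′) :+ x :* T′ := c :* S :+ (c :+ x) :* T′) refl c x S T′ ⟩
      c * S + (c + x) * T′          ≡⟨ cong (λ y → c * S + y * T′) (solve 2 (λ t x → t :- x :+ x := t) refl (ℕ→ℚ 3) x) ⟩
      c * S + ℕ→ℚ 3 * T′            ≤⟨ ℚ.+-monoʳ-≤ (c * S) (*-monoʳ-≤ T′ (term-nonNeg (3 ℕ.+ t) 0≤x) (ℕ→ℚ-mono-≤ (ℕ.m≤m+n 3 t))) ⟩
      c * S + ℕ→ℚ (3 ℕ.+ t) * T′    ≡⟨ cong (c * S +_) (term-suc (2 ℕ.+ t) x) ⟩
      c * S + x * term (2 ℕ.+ t) x  ≤⟨ invariant t ⟩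
      V                             ∎
      where
      S T′ : ℚ
      S  = expSum (2 ℕ.+ t) x
      T′ = term (3 ℕ.+ t) x

  module _ (n : ℕ) {x : ℚ} (0≤x : 0ℚ ≤ x) (x≤1 : x ≤ 1ℚ) where

    private
      S c V : ℚ
      S = expSum n x
      c = ℕ→ℚ 3 - x
      V = ℕ→ℚ 3 + ℕ→ℚ 2 * x + ½ * (x * x)
      0<c : 0ℚ < c
      0<c = ℚ.<-≤-trans (ℚ.positive⁻¹ (ℕ→ℚ 2)) (ℚ.+-monoʳ-≤ (ℕ→ℚ 3) (ℚ.neg-antimono-≤ x≤1))
      0≤1-x : 0ℚ ≤ 1ℚ - x
      0≤1-x = p≤q⇒0≤q-p x≤1
      cS≤V : c * S ≤ V
      cS≤V = expSum-tail-≤ n 0≤x (ℚ.≤-trans x≤1 (ℕ→ℚ-mono-≤ {1} {3} (ℕ.s≤s ℕ.z≤n)))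
      0≤cS : 0ℚ ≤ c * S
      0≤cS = *-nonNeg (ℚ.<⇒≤ 0<c) (expSum-nonNeg n 0≤x)

    expSum-*-[1-x]-≤-1 : expSum n x * (1ℚ - x) ≤ 1ℚ
    expSum-*-[1-x]-≤-1 = *-cancelˡ-≤ c 0<c (begin
      c * (S * (1ℚ - x))                           ≡⟨ ℚ.*-assoc c S (1ℚ - x) ⟨
      c * S * (1ℚ - x)                             ≤⟨ *-monoʳ-≤ (1ℚ - x) 0≤1-x cS≤V ⟩
      V * (1ℚ - x)                                 ≤⟨ p≤p+q (*-nonNeg (*-nonNeg 0≤x 0≤x) 0≤linear) ⟩
      V * (1ℚ - x) + x * x * linear                ≡⟨ solve 1 (λ x →
                                                        (con (ℕ→ℚ 3) :+ con (ℕ→ℚ 2) :* x :+ con ½ :* (x :* x)) :* (con 1ℚ :- x)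
                                                          :+ x :* x :* (con (ℤ.+ 3 / 2) :+ con ½ :* x)
                                                        := (con (ℕ→ℚ 3) :- x) :* con 1ℚ) refl x ⟩
      c * 1ℚ                                       ∎)
      where
      open ℚ.≤-Reasoning
      linear = ℤ.+ 3 / 2 + ½ * x
      0≤linear : 0ℚ ≤ linear
      0≤linear = ℚ.+-mono-≤ (ℚ.nonNegative⁻¹ (ℤ.+ 3 / 2)) (*-nonNeg (ℚ.nonNegative⁻¹ ½) 0≤x)

    expSum²-*-[1-x]-≤-1+x : expSum n x * expSum n x * (1ℚ - x) ≤ 1ℚ + x
    expSum²-*-[1-x]-≤-1+x = *-cancelˡ-≤ c 0<c (*-cancelˡ-≤ c 0<c (begin
      c * (c * (S * S * (1ℚ - x)))                 ≡⟨ solve 3 (λ c S y → c :* (c :* (S :* S :* y)) := c :* S :* (c :* S) :* y) refl c S (1ℚ - x) ⟩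
      c * S * (c * S) * (1ℚ - x)                   ≤⟨ *-monoʳ-≤ (1ℚ - x) 0≤1-x (*-mono-≤ (ℚ.≤-trans 0≤cS cS≤V) 0≤cS cS≤V cS≤V) ⟩
      V * V * (1ℚ - x)                             ≤⟨ p≤p+q (*-nonNeg (*-nonNeg (*-nonNeg 0≤x 0≤x) 0≤x) 0≤quadratic) ⟩
      V * V * (1ℚ - x) + x * x * x * quadratic     ≡⟨ solve 1 (λ x →
                                                        (con (ℕ→ℚ 3) :+ con (ℕ→ℚ 2) :* x :+ con ½ :* (x :* x))
                                                          :* (con (ℕ→ℚ 3) :+ con (ℕ→ℚ 2) :* x :+ con ½ :* (x :* x)) :* (con 1ℚ :- x)
                                                          :+ x :* x :* x :* (con (ℕ→ℚ 6) :+ con (ℤ.+ 7 / 4) :* x :+ con (ℤ.+ 1 / 4) :* (x :* x))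
                                                        := (con (ℕ→ℚ 3) :- x) :* ((con (ℕ→ℚ 3) :- x) :* (con 1ℚ :+ x))) refl x ⟩
      c * (c * (1ℚ + x))                           ∎))
      where
      open ℚ.≤-Reasoning
      quadratic = ℕ→ℚ 6 + ℤ.+ 7 / 4 * x + ℤ.+ 1 / 4 * (x * x)
      0≤quadratic : 0ℚ ≤ quadratic
      0≤quadratic = ℚ.+-mono-≤ (ℚ.+-mono-≤ (ℕ→ℚ-nonNeg 6) (*-nonNeg (ℚ.nonNegative⁻¹ (ℤ.+ 7 / 4)) 0≤x))
                              (*-nonNeg (ℚ.nonNegative⁻¹ (ℤ.+ 1 / 4)) (*-nonNeg 0≤x 0≤x))

  expSum-*-≤ : ∀ n J → expSum n (1/ℕ (suc J)) * ℕ→ℚ J ≤ ℕ→ℚ (suc J)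
  expSum-*-≤ n J = begin
    S * ℕ→ℚ J                     ≡⟨ cong (S *_) (ℕ→ℚ-*-1-1/ℕ J) ⟨
    S * (ℕ→ℚ (suc J) * (1ℚ - x))  ≡⟨ solve 3 (λ S m y → S :* (m :* y) := m :* (S :* y)) refl S (ℕ→ℚ (suc J)) (1ℚ - x) ⟩
    ℕ→ℚ (suc J) * (S * (1ℚ - x))  ≤⟨ *-monoˡ-≤ (ℕ→ℚ (suc J)) (ℕ→ℚ-nonNeg (suc J)) (expSum-*-[1-x]-≤-1 n (1/ℕ-nonNeg (suc J)) (1/ℕ-≤-1 J)) ⟩
    ℕ→ℚ (suc J) * 1ℚ              ≡⟨ ℚ.*-identityʳ (ℕ→ℚ (suc J)) ⟩
    ℕ→ℚ (suc J)                   ∎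
    where
    open ℚ.≤-Reasoning
    x = 1/ℕ (suc J)
    S = expSum n x

  expSum²-*-≤ : ∀ n j → let S = expSum n (1/ℕ (suc (j ℕ.+ j))) in S * S * ℕ→ℚ j ≤ ℕ→ℚ (suc j)
  expSum²-*-≤ n j = *-cancelˡ-≤ (ℕ→ℚ 2) (ℕ→ℚ-pos 1) (begin
    ℕ→ℚ 2 * (S * S * ℕ→ℚ j)     ≡⟨ solve 2 (λ S a → con (ℕ→ℚ 2) :* (S :* S :* a) := S :* S :* (a :+ a)) refl S (ℕ→ℚ j) ⟩
    S * S * (ℕ→ℚ j + ℕ→ℚ j)     ≡⟨ cong (S * S *_) (ℕ→ℚ-homo-+ j j) ⟨
    S * S * ℕ→ℚ (j ℕ.+ j)       ≡⟨ cong (S * S *_) (ℕ→ℚ-*-1-1/ℕ (j ℕ.+ j)) ⟨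
    S * S * (ℕ→ℚ N * (1ℚ - x))  ≡⟨ solve 3 (λ a m y → a :* (m :* y) := m :* (a :* y)) refl (S * S) (ℕ→ℚ N) (1ℚ - x) ⟩
    ℕ→ℚ N * (S * S * (1ℚ - x))  ≤⟨ *-monoˡ-≤ (ℕ→ℚ N) (ℕ→ℚ-nonNeg N) (expSum²-*-[1-x]-≤-1+x n (1/ℕ-nonNeg N) (1/ℕ-≤-1 (j ℕ.+ j))) ⟩
    ℕ→ℚ N * (1ℚ + x)            ≡⟨ ℕ→ℚ-*-1+1/ℕ (j ℕ.+ j) ⟩
    ℕ→ℚ (suc N)                 ≡⟨ cong (λ m → ℕ→ℚ (suc m)) (ℕ.+-suc j j) ⟨
    ℕ→ℚ (suc j ℕ.+ suc j)       ≡⟨ ℕ→ℚ-homo-+ (suc j) (suc j) ⟩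
    ℕ→ℚ (suc j) + ℕ→ℚ (suc j)   ≡⟨ solve 1 (λ a → a :+ a := con (ℕ→ℚ 2) :* a) refl (ℕ→ℚ (suc j)) ⟩
    ℕ→ℚ 2 * ℕ→ℚ (suc j)         ∎)
    where
    open ℚ.≤-Reasoning
    N = suc (j ℕ.+ j)
    x = 1/ℕ N
    S = expSum n x

  -- Stirling-type bounds

  eSum-*-^-≤ : ∀ n J → eSum n * ℕ→ℚ J ^ℚ suc J ≤ ℕ→ℚ (suc J) ^ℚ suc J
  eSum-*-^-≤ n J = begin
    eSum n * ℕ→ℚ J ^ℚ suc J      ≤⟨ *-monoʳ-≤ _ (^ℚ-nonNeg (suc J) (ℕ→ℚ-nonNeg J)) (eSum-≤-expSum^ n J) ⟩
    S ^ℚ suc J * ℕ→ℚ J ^ℚ suc J  ≡⟨ ^ℚ-distribʳ-* S (ℕ→ℚ J) (suc J) ⟨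
    (S * ℕ→ℚ J) ^ℚ suc J         ≤⟨ ^ℚ-monoˡ-≤ (suc J) (*-nonNeg (expSum-nonNeg n (1/ℕ-nonNeg (suc J))) (ℕ→ℚ-nonNeg J)) (expSum-*-≤ n J) ⟩
    ℕ→ℚ (suc J) ^ℚ suc J         ∎
    where
    open ℚ.≤-Reasoning
    S = expSum n (1/ℕ (suc J))

  eSum²-*-^-≤ : ∀ n j → let N = suc (j ℕ.+ j) in eSum n * eSum n * ℕ→ℚ j ^ℚ N ≤ ℕ→ℚ (suc j) ^ℚ N
  eSum²-*-^-≤ n j = begin
    eSum n * eSum n * ℕ→ℚ j ^ℚ N  ≤⟨ *-monoʳ-≤ _ (^ℚ-nonNeg N (ℕ→ℚ-nonNeg j)) (*-mono-≤ (^ℚ-nonNeg N 0≤S) (eSum-nonNeg n) s≤S^N s≤S^N) ⟩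
    S ^ℚ N * S ^ℚ N * ℕ→ℚ j ^ℚ N  ≡⟨ cong (_* ℕ→ℚ j ^ℚ N) (^ℚ-distribʳ-* S S N) ⟨
    (S * S) ^ℚ N * ℕ→ℚ j ^ℚ N     ≡⟨ ^ℚ-distribʳ-* (S * S) (ℕ→ℚ j) N ⟨
    (S * S * ℕ→ℚ j) ^ℚ N          ≤⟨ ^ℚ-monoˡ-≤ N (*-nonNeg (*-nonNeg 0≤S 0≤S) (ℕ→ℚ-nonNeg j)) (expSum²-*-≤ n j) ⟩
    ℕ→ℚ (suc j) ^ℚ N              ∎
    where
    open ℚ.≤-Reasoning
    N = suc (j ℕ.+ j)
    S = expSum n (1/ℕ N)
    0≤S = expSum-nonNeg n (1/ℕ-nonNeg N)
    s≤S^N = eSum-≤-expSum^ n (j ℕ.+ j)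

  factorial²-bound : ∀ n m → ℕ→ℚ (m !) * ℕ→ℚ (m !) * eSum n ^ℚ (m ℕ.+ m) ≤ ℕ→ℚ (suc m) ^ℚ suc (m ℕ.+ m)
  factorial²-bound n zero    = ℚ.≤-refl
  factorial²-bound n (suc m) = begin
    ℕ→ℚ (suc m !) * ℕ→ℚ (suc m !) * s ^ℚ (suc m ℕ.+ suc m)
      ≡⟨ cong₂ _*_ (cong₂ _*_ (ℕ→ℚ-homo-* (suc m) (m !)) (ℕ→ℚ-homo-* (suc m) (m !))) (^ℚ-suc-+-suc s m) ⟩
    a * f * (a * f) * (s * (s * s ^ℚ (m ℕ.+ m)))
      ≡⟨ solve 4 (λ a f s x → a :* f :* (a :* f) :* (s :* (s :* x)) := a :* a :* (s :* s) :* (f :* f :* x)) refl a f s (s ^ℚ (m ℕ.+ m)) ⟩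
    a * a * (s * s) * (f * f * s ^ℚ (m ℕ.+ m))
      ≤⟨ *-monoˡ-≤ _ (*-nonNeg (*-nonNeg 0≤a 0≤a) (*-nonNeg 0≤s 0≤s)) (factorial²-bound n m) ⟩
    a * a * (s * s) * a ^ℚ suc (m ℕ.+ m)
      ≡⟨ solve 3 (λ a s y → a :* a :* (s :* s) :* y := s :* s :* (a :* (a :* y))) refl a s (a ^ℚ suc (m ℕ.+ m)) ⟩
    s * s * (a * (a * a ^ℚ suc (m ℕ.+ m)))
      ≡⟨ cong (λ e → s * s * a ^ℚ suc (suc e)) (ℕ.+-suc m m) ⟨
    s * s * a ^ℚ suc (suc m ℕ.+ suc m)
      ≤⟨ eSum²-*-^-≤ n (suc m) ⟩
    ℕ→ℚ (suc (suc m)) ^ℚ suc (suc m ℕ.+ suc m)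
      ∎
    where
    open ℚ.≤-Reasoning
    s = eSum n
    a = ℕ→ℚ (suc m)
    f = ℕ→ℚ (m !)
    0≤a = ℕ→ℚ-nonNeg (suc m)
    0≤s = eSum-nonNeg n

  module _ (n m : ℕ) where

    private
      s a f : ℚ
      s = eSum n
      a = ℕ→ℚ (suc m)
      f = ℕ→ℚ (m !)
      0≤s = eSum-nonNeg n
      0≤a = ℕ→ℚ-nonNeg (suc m)
      K = suc m ℕ.+ suc m

      2^k*a^k≡K^k : ∀ k → ℕ→ℚ 2 ^ℚ k * a ^ℚ k ≡ ℕ→ℚ K ^ℚ k
      2^k*a^k≡K^k k = begin
        ℕ→ℚ 2 ^ℚ k * a ^ℚ k  ≡⟨ ^ℚ-distribʳ-* (ℕ→ℚ 2) a k ⟨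
        (ℕ→ℚ 2 * a) ^ℚ k     ≡⟨ cong (_^ℚ k) (solve 1 (λ a → con (ℕ→ℚ 2) :* a := a :+ a) refl a) ⟩
        (a + a) ^ℚ k         ≡⟨ cong (_^ℚ k) (ℕ→ℚ-homo-+ (suc m) (suc m)) ⟨
        ℕ→ℚ K ^ℚ k           ∎
        where open ≡-Reasoning

    even-order-bound : ℕ→ℚ (suc m ! ℕ.* m !) * ℕ→ℚ (2 ℕ.^ K) * s ^ℚ K ≤ ℕ→ℚ (K ℕ.^ K) * s ^ℚ 2
    even-order-bound = begin
      ℕ→ℚ (suc m ! ℕ.* m !) * ℕ→ℚ (2 ℕ.^ K) * s ^ℚ K
        ≡⟨ cong₂ _*_ (cong₂ _*_ (trans (ℕ→ℚ-homo-* (suc m !) (m !)) (cong (_* f) (ℕ→ℚ-homo-* (suc m) (m !))))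
                                (ℕ→ℚ-homo-^ 2 K))
                     (^ℚ-suc-+-suc s m) ⟩
      a * f * f * t * (s * (s * x))
        ≡⟨ solve 5 (λ a f t s x → a :* f :* f :* t :* (s :* (s :* x)) := a :* t :* (s :* (s :* con 1ℚ)) :* (f :* f :* x)) refl a f t s x ⟩
      a * t * s ^ℚ 2 * (f * f * x)
        ≤⟨ *-monoˡ-≤ _ (*-nonNeg (*-nonNeg 0≤a (^ℚ-nonNeg K (ℕ→ℚ-nonNeg 2))) (^ℚ-nonNeg 2 0≤s)) (factorial²-bound n m) ⟩
      a * t * s ^ℚ 2 * a ^ℚ suc (m ℕ.+ m)
        ≡⟨ solve 4 (λ a t y z → a :* t :* z :* y := t :* (a :* y) :* z) refl a t (a ^ℚ suc (m ℕ.+ m)) (s ^ℚ 2) ⟩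
      t * (a * a ^ℚ suc (m ℕ.+ m)) * s ^ℚ 2
        ≡⟨ cong (λ e → t * a ^ℚ suc e * s ^ℚ 2) (ℕ.+-suc m m) ⟨
      t * a ^ℚ K * s ^ℚ 2
        ≡⟨ cong (_* s ^ℚ 2) (trans (2^k*a^k≡K^k K) (sym (ℕ→ℚ-homo-^ K K))) ⟩
      ℕ→ℚ (K ℕ.^ K) * s ^ℚ 2
        ∎
      where
      open ℚ.≤-Reasoning
      t = ℕ→ℚ 2 ^ℚ K
      x = s ^ℚ (m ℕ.+ m)

    odd-order-bound : ℕ→ℚ (suc m ! ℕ.* suc m !) * ℕ→ℚ (2 ℕ.^ suc K) * s ^ℚ suc K ≤ ℕ→ℚ (suc K ℕ.^ suc K) * s ^ℚ 2
    odd-order-bound = begin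
      ℕ→ℚ (suc m ! ℕ.* suc m !) * ℕ→ℚ (2 ℕ.^ suc K) * s ^ℚ suc K
        ≡⟨ cong₂ _*_ (cong₂ _*_ (trans (ℕ→ℚ-homo-* (suc m !) (suc m !)) (cong₂ _*_ (ℕ→ℚ-homo-* (suc m) (m !)) (ℕ→ℚ-homo-* (suc m) (m !))))
                                (ℕ→ℚ-homo-^ 2 (suc K)))
                     (cong (s *_) (^ℚ-suc-+-suc s m)) ⟩
      a * f * (a * f) * t * (s * (s * (s * x)))
        ≡⟨ solve 5 (λ a f t s x → a :* f :* (a :* f) :* t :* (s :* (s :* (s :* x))) := a :* a :* t :* s :* (s :* (s :* con 1ℚ)) :* (f :* f :* x)) refl a f t s x ⟩
      a * a * t * s * s ^ℚ 2 * (f * f * x)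
        ≤⟨ *-monoˡ-≤ _ (*-nonNeg (*-nonNeg (*-nonNeg (*-nonNeg 0≤a 0≤a) (^ℚ-nonNeg (suc K) (ℕ→ℚ-nonNeg 2))) 0≤s) (^ℚ-nonNeg 2 0≤s)) (factorial²-bound n m) ⟩
      a * a * t * s * s ^ℚ 2 * a ^ℚ suc (m ℕ.+ m)
        ≡⟨ solve 5 (λ a t s y z → a :* a :* t :* s :* z :* y := s :* (t :* (a :* (a :* y))) :* z) refl a t s (a ^ℚ suc (m ℕ.+ m)) (s ^ℚ 2) ⟩
      s * (t * (a * (a * a ^ℚ suc (m ℕ.+ m)))) * s ^ℚ 2
        ≡⟨ cong (λ e → s * (t * a ^ℚ suc (suc e)) * s ^ℚ 2) (ℕ.+-suc m m) ⟨
      s * (t * a ^ℚ suc K) * s ^ℚ 2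
        ≡⟨ cong (λ y → s * y * s ^ℚ 2) (2^k*a^k≡K^k (suc K)) ⟩
      s * ℕ→ℚ K ^ℚ suc K * s ^ℚ 2
        ≤⟨ *-monoʳ-≤ _ (^ℚ-nonNeg 2 0≤s) (eSum-*-^-≤ n K) ⟩
      ℕ→ℚ (suc K) ^ℚ suc K * s ^ℚ 2
        ≡⟨ cong (_* s ^ℚ 2) (ℕ→ℚ-homo-^ (suc K) (suc K)) ⟨
      ℕ→ℚ (suc K ℕ.^ suc K) * s ^ℚ 2
        ∎
      where
      open ℚ.≤-Reasoning
      t = ℕ→ℚ 2 ^ℚ suc K
      x = s ^ℚ (m ℕ.+ m)

module Counting where

  open import Data.Nat.Base using (ℕ; zero; suc; _+_; _*_; _∸_; _≤_; _<_; z≤n; s≤s; _!; ⌊_/2⌋; ⌈_/2⌉)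
  import Data.Nat.Properties as ℕ
  open import Data.Nat.Tactic.RingSolver using (solve-∀)
  open import Data.Fin.Base using (Fin; zero; suc; toℕ; fromℕ<; punchOut; inject₁)
  import Data.Fin.Properties as Fin
  open import Data.Fin.Properties using (_≟_)
  open import Data.Bool.Base using (Bool; true; false; _∧_; not; if_then_else_)
  open import Data.Bool.Properties using (∧-conicalˡ; ∧-conicalʳ; ⇔→≡)
  open import Data.Product.Base using (∃; _×_; _,_; proj₁; proj₂)
  open import Data.Sum.Base using (_⊎_; inj₁; inj₂)
  open import Data.List.Base using (List; []; _∷_; length; tabulate)
  import Data.List.Properties as List
  open import Data.List.Relation.Unary.All using (All; []; _∷_; reduce)
  open import Data.List.Relation.Unary.AllPairs using (AllPairs; []; _∷_)
  open import Data.Empty using (⊥; ⊥-elim)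
  open import Function.Base using (_∘_; id; case_of_)
  open import Function.Bundles using (mk⇔)
  open import Function.Definitions using (Injective)
  open import Relation.Nullary.Decidable.Core using (does; yes; no)
  open import Relation.Binary.PropositionalEquality
  open import Algebra.Properties.CommutativeMonoid.Sum ℕ.+-0-commutativeMonoid
    using (sum; ∑-distrib-+; sum-cong-≗; sum-replicate-zero)
  open import Algebra.Properties.Semiring.Sum ℕ.+-*-semiring using (*-distribʳ-sum)

  pathBound : ℕ → ℕ
  pathBound m = ⌈ m /2⌉ ! * ⌊ m /2⌋ !

  *-≤-⌈/2⌉*⌊/2⌋ : ∀ x y → x * y ≤ ⌈ (x + y) /2⌉ * ⌊ (x + y) /2⌋
  *-≤-⌈/2⌉*⌊/2⌋ zero    y       = z≤n
  *-≤-⌈/2⌉*⌊/2⌋ (suc x) zero    = ℕ.≤-trans (ℕ.≤-reflexive (ℕ.*-zeroʳ (suc x))) z≤n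
  *-≤-⌈/2⌉*⌊/2⌋ (suc x) (suc y) rewrite ℕ.+-suc x y = begin
    suc x * suc y        ≡⟨ expand x y ⟩
    suc (x + y) + x * y  ≤⟨ ℕ.+-monoʳ-≤ (suc (x + y)) (*-≤-⌈/2⌉*⌊/2⌋ x y) ⟩
    suc (x + y) + a * b  ≡⟨ cong (λ n → suc n + a * b) (trans (sym (ℕ.⌊n/2⌋+⌈n/2⌉≡n (x + y))) (ℕ.+-comm b a)) ⟩
    suc (a + b) + a * b  ≡⟨ expand a b ⟨
    suc a * suc b        ∎
    where
    open ℕ.≤-Reasoning
    a = ⌈ (x + y) /2⌉
    b = ⌊ (x + y) /2⌋
    expand : ∀ x y → suc x * suc y ≡ suc (x + y) + x * y
    expand = solve-∀

  pathBound-step : ∀ m c → c ≤ 2 + m → c * ((2 + m ∸ c) * pathBound m) ≤ pathBound (2 + m)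
  pathBound-step m c c≤2+m = begin
    c * ((2 + m ∸ c) * pathBound m)  ≡⟨ ℕ.*-assoc c (2 + m ∸ c) (pathBound m) ⟨
    c * (2 + m ∸ c) * pathBound m    ≤⟨ ℕ.*-monoˡ-≤ (pathBound m) c*[2+m∸c]≤ ⟩
    suc a * suc b * (a ! * b !)      ≡⟨ interchange (suc a) (suc b) (a !) (b !) ⟩
    pathBound (2 + m)                ∎
    where
    open ℕ.≤-Reasoning
    a = ⌈ m /2⌉
    b = ⌊ m /2⌋
    c*[2+m∸c]≤ : c * (2 + m ∸ c) ≤ suc a * suc b
    c*[2+m∸c]≤ = subst (λ n → c * (2 + m ∸ c) ≤ ⌈ n /2⌉ * ⌊ n /2⌋) (ℕ.m+[n∸m]≡n c≤2+m) (*-≤-⌈/2⌉*⌊/2⌋ c (2 + m ∸ c))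
    interchange : ∀ a b f g → a * b * (f * g) ≡ a * f * (b * g)
    interchange = solve-∀

  allVertices : ∀ {n} → Fin n → Bool
  allVertices _ = true

  _-_ : ∀ {n} → (Fin n → Bool) → Fin n → (Fin n → Bool)
  (U - w) u = U u ∧ not (does (u ≟ w))

  _⊆_ : ∀ {n} → (Fin n → Bool) → (Fin n → Bool) → Set
  U ⊆ V = ∀ i → U i ≡ true → V i ≡ true

  ∣_∣ : ∀ {n} → (Fin n → Bool) → ℕ
  ∣ U ∣ = sum (λ i → if U i then 1 else 0)

  sum-mono-≤ : ∀ {n} {f g : Fin n → ℕ} → (∀ i → f i ≤ g i) → sum f ≤ sum g
  sum-mono-≤ {zero}  f≤g = z≤n
  sum-mono-≤ {suc n} f≤g = ℕ.+-mono-≤ (f≤g zero) (sum-mono-≤ (f≤g ∘ suc))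

  sum-indicator : ∀ {n} (w : Fin n) → sum (λ i → if does (i ≟ w) then 1 else 0) ≡ 1
  sum-indicator {suc n} zero    = cong suc (sum-replicate-zero n)
  sum-indicator {suc n} (suc w) = sum-indicator w

  ∣allVertices∣≡n : ∀ n → ∣ allVertices {n} ∣ ≡ n
  ∣allVertices∣≡n zero    = refl
  ∣allVertices∣≡n (suc n) = cong suc (∣allVertices∣≡n n)

  ∣-∣-mono-⊆ : ∀ {n} {U V : Fin n → Bool} → U ⊆ V → ∣ U ∣ ≤ ∣ V ∣
  ∣-∣-mono-⊆ {U = U} {V} U⊆V = sum-mono-≤ pointwise
    where
    pointwise : ∀ i → (if U i then 1 else 0) ≤ (if V i then 1 else 0)
    pointwise i with U i in Ui
    ... | false = z≤n
    ... | true rewrite U⊆V i Ui = ℕ.≤-refl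

  ∣-∣-disjoint : ∀ {n} {U V W : Fin n → Bool} → (∀ i → U i ≡ true → V i ≡ true → ⊥) →
                 U ⊆ W → V ⊆ W → ∣ U ∣ + ∣ V ∣ ≤ ∣ W ∣
  ∣-∣-disjoint {U = U} {V} {W} disjoint U⊆W V⊆W = begin
    ∣ U ∣ + ∣ V ∣                                                ≡⟨ ∑-distrib-+ [U] [V] ⟨
    sum (λ i → (if U i then 1 else 0) + (if V i then 1 else 0))  ≤⟨ sum-mono-≤ pointwise ⟩
    ∣ W ∣                                                        ∎
    where
    open ℕ.≤-Reasoning
    [U] [V] : Fin _ → ℕ
    [U] i = if U i then 1 else 0
    [V] i = if V i then 1 else 0
    pointwise : ∀ i → [U] i + [V] i ≤ (if W i then 1 else 0)
    pointwise i with U i in Ui | V i in Vi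
    ... | true  | true  = ⊥-elim (disjoint i Ui Vi)
    ... | true  | false rewrite U⊆W i Ui = ℕ.≤-refl
    ... | false | true  rewrite V⊆W i Vi = ℕ.≤-refl
    ... | false | false = z≤n

  ∣-∣-remove : ∀ {n} (U : Fin n → Bool) {w} → U w ≡ true → suc ∣ U - w ∣ ≡ ∣ U ∣
  ∣-∣-remove U {w} Uw = begin
    suc ∣ U - w ∣               ≡⟨ ℕ.+-comm 1 ∣ U - w ∣ ⟩
    ∣ U - w ∣ + 1               ≡⟨ cong (∣ U - w ∣ +_) (sum-indicator w) ⟨
    ∣ U - w ∣ + sum [w]         ≡⟨ ∑-distrib-+ [U-w] [w] ⟨
    sum (λ i → [U-w] i + [w] i) ≡⟨ sum-cong-≗ pointwise ⟩
    ∣ U ∣                       ∎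
    where
    open ≡-Reasoning
    [U-w] [w] : Fin _ → ℕ
    [U-w] i = if (U - w) i then 1 else 0
    [w]   i = if does (i ≟ w) then 1 else 0
    pointwise : ∀ i → [U-w] i + [w] i ≡ (if U i then 1 else 0)
    pointwise i with i ≟ w
    ... | yes refl rewrite Uw = refl
    ... | no _ with U i
    ...   | true  = refl
    ...   | false = refl

  -- Paths that visit each vertex at most once

  module _ {k : ℕ} (H : Graph k) where

    candidates : (Fin k → Bool) → Fin k → (Fin k → Bool)
    candidates U v w = U w ∧ adj H v w

    data Path : Fin k → (Fin k → Bool) → ℕ → List (Fin k) → Set where
      []   : ∀ {v U} → Path v U 0 []
      step : ∀ {v U w m p} → candidates U v w ≡ true → Path w (U - w) m p → Path v U (suc m) (w ∷ p)

    tabulate-Path : ∀ {m} (w : Fin (suc m) → Fin k) {U} → Injective _≡_ _≡_ (w ∘ suc) → (∀ i → U (w (suc i)) ≡ true) →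
                    (∀ i → adj H (w (inject₁ i)) (w (suc i)) ≡ true) → Path (w zero) U m (tabulate (w ∘ suc))
    tabulate-Path {zero}  w _ _ _ = []
    tabulate-Path {suc m} w {U} w-injective w∈U adjacent =
      step (cong₂ _∧_ (w∈U zero) (adjacent zero))
           (tabulate-Path (w ∘ suc) (λ eq → Fin.suc-injective (w-injective eq)) w∈U-w₁ (adjacent ∘ suc))
      where
      w∈U-w₁ : ∀ i → (U - w (suc zero)) (w (suc (suc i))) ≡ true
      w∈U-w₁ i with w (suc (suc i)) ≟ w (suc zero)
      ... | yes w₂₊ᵢ≡w₁ = case w-injective w₂₊ᵢ≡w₁ of λ ()
      ... | no  _       = cong (_∧ true) (w∈U (suc i))

    tailsFrom : Fin k → List (List (Fin k)) → List (List (Fin k))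
    tailsFrom w []            = []
    tailsFrom w ([] ∷ L)      = tailsFrom w L
    tailsFrom w ((x ∷ p) ∷ L) = if does (x ≟ w) then p ∷ tailsFrom w L else tailsFrom w L

    tailsFrom-distinct : ∀ w L → AllPairs _≢_ L → AllPairs _≢_ (tailsFrom w L)
    tailsFrom-distinct w []            []                = []
    tailsFrom-distinct w ([] ∷ L)      (_ ∷ distinct)    = tailsFrom-distinct w L distinct
    tailsFrom-distinct w ((x ∷ p) ∷ L) (x∷p≢ ∷ distinct) with x ≟ w
    ... | yes refl = p≢tails L x∷p≢ ∷ tailsFrom-distinct w L distinct
      where
      p≢tails : ∀ L → All ((x ∷ p) ≢_) L → All (p ≢_) (tailsFrom x L)
      p≢tails []            []         = []
      p≢tails ([] ∷ L)      (_ ∷ ≢L)   = p≢tails L ≢L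
      p≢tails ((y ∷ q) ∷ L) (≢yq ∷ ≢L) with y ≟ x
      ... | yes refl = (λ p≡q → ≢yq (cong (y ∷_) p≡q)) ∷ p≢tails L ≢L
      ... | no _     = p≢tails L ≢L
    ... | no _     = tailsFrom-distinct w L distinct

    module _ {v : Fin k} {U : Fin k → Bool} {m : ℕ} where

      tailsFrom-Path : ∀ w L → All (Path v U (suc m)) L → All (Path w (U - w) m) (tailsFrom w L)
      tailsFrom-Path w []            []                    = []
      tailsFrom-Path w ((x ∷ p) ∷ L) (step _ path ∷ paths) with x ≟ w
      ... | yes refl = path ∷ tailsFrom-Path w L paths
      ... | no _     = tailsFrom-Path w L paths

      tailsFrom-[] : ∀ w L → All (Path v U (suc m)) L → candidates U v w ≡ false → tailsFrom w L ≡ []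
      tailsFrom-[] w []            []                    _     = refl
      tailsFrom-[] w ((x ∷ p) ∷ L) (step cand _ ∷ paths) ¬cand with x ≟ w
      ... | yes refl = case trans (sym cand) ¬cand of λ ()
      ... | no _     = tailsFrom-[] w L paths ¬cand

      length≡∑tailsFrom : ∀ L → All (Path v U (suc m)) L → length L ≡ sum (λ w → length (tailsFrom w L))
      length≡∑tailsFrom []            []          = sym (sum-replicate-zero k)
      length≡∑tailsFrom ((x ∷ p) ∷ L) (_ ∷ paths) = begin
        suc (length L)                              ≡⟨ cong₂ _+_ (sum-indicator x) (sym (length≡∑tailsFrom L paths)) ⟨
        sum [x] + sum (λ w → length (tailsFrom w L))  ≡⟨ ∑-distrib-+ [x] (λ w → length (tailsFrom w L)) ⟨
        sum (λ w → [x] w + length (tailsFrom w L))    ≡⟨ sum-cong-≗ pointwise ⟩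
        sum (λ w → length (tailsFrom w ((x ∷ p) ∷ L))) ∎
        where
        open ≡-Reasoning
        [x] : Fin k → ℕ
        [x] w = if does (w ≟ x) then 1 else 0
        pointwise : ∀ w → [x] w + length (tailsFrom w L) ≡ length (tailsFrom w ((x ∷ p) ∷ L))
        pointwise w with w ≟ x | x ≟ w
        ... | yes refl | yes _    = refl
        ... | yes refl | no x≢x   = ⊥-elim (x≢x refl)
        ... | no w≢x   | yes refl = ⊥-elim (w≢x refl)
        ... | no _     | no _     = refl

      length-≤-∣candidates∣* : ∀ L B →
        (∀ w → candidates U v w ≡ true → ∀ L′ → All (Path w (U - w) m) L′ → AllPairs _≢_ L′ → length L′ ≤ B) →
        All (Path v U (suc m)) L → AllPairs _≢_ L → length L ≤ ∣ candidates U v ∣ * B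
      length-≤-∣candidates∣* L B bound paths distinct = begin
        length L                                             ≡⟨ length≡∑tailsFrom L paths ⟩
        sum (λ w → length (tailsFrom w L))                   ≤⟨ sum-mono-≤ pointwise ⟩
        sum (λ w → (if candidates U v w then 1 else 0) * B)  ≡⟨ *-distribʳ-sum B (λ w → if candidates U v w then 1 else 0) ⟨
        ∣ candidates U v ∣ * B                               ∎
        where
        open ℕ.≤-Reasoning
        pointwise : ∀ w → length (tailsFrom w L) ≤ (if candidates U v w then 1 else 0) * B
        pointwise w with candidates U v w in cand
        ... | true  = ℕ.≤-trans (bound w cand (tailsFrom w L) (tailsFrom-Path w L paths) (tailsFrom-distinct w L distinct))
                                (ℕ.≤-reflexive (sym (ℕ.*-identityˡ B)))
        ... | false = ℕ.≤-reflexive (cong length (tailsFrom-[] w L paths cand))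

    module _ (triangleFree : TriangleFree H) where

      private
        candidates-⊆ : ∀ U v → candidates U v ⊆ U
        candidates-⊆ U v u cand = ∧-conicalˡ (U u) _ cand

        ∣U-w∣≤ : ∀ {U v w m} → ∣ U ∣ ≤ suc m → candidates U v w ≡ true → ∣ U - w ∣ ≤ m
        ∣U-w∣≤ {U} U≤1+m cand = ℕ.≤-pred (ℕ.≤-trans (ℕ.≤-reflexive (∣-∣-remove U (candidates-⊆ U _ _ cand))) U≤1+m)

        candidates-disjoint : ∀ {U v w} → candidates U v w ≡ true →
                              ∀ u → candidates (U - w) w u ≡ true → candidates U v u ≡ true → ⊥
        candidates-disjoint {U} {v} {w} vw u wu vu =
          triangleFree (v , w , u , ∧-conicalʳ (U w) _ vw , ∧-conicalʳ ((U - w) u) _ wu , ∧-conicalʳ (U u) _ vu)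

      paths-bound : ∀ m {v U} L → ∣ U ∣ ≤ m → All (Path v U m) L → AllPairs _≢_ L → length L ≤ pathBound m
      paths-bound-by-first-step : ∀ m {v U} L → ∣ U ∣ ≤ suc m → All (Path v U (suc m)) L → AllPairs _≢_ L →
                                  length L ≤ ∣ candidates U v ∣ * pathBound m

      paths-bound zero          []          _ []            _                = z≤n
      paths-bound zero          (_ ∷ [])    _ _             _                = s≤s z≤n
      paths-bound zero          (_ ∷ _ ∷ _) _ ([] ∷ [] ∷ _) ((≢[] ∷ _) ∷ _)  = ⊥-elim (≢[] refl)
      paths-bound (suc zero)    {v} {U} L U≤1 paths distinct =
        ℕ.≤-trans (paths-bound-by-first-step 0 L U≤1 paths distinct)
                  (ℕ.≤-trans (ℕ.≤-reflexive (ℕ.*-identityʳ _)) (ℕ.≤-trans (∣-∣-mono-⊆ (candidates-⊆ U v)) U≤1))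
      paths-bound (suc (suc m)) {v} {U} L U≤2+m paths distinct =
        ℕ.≤-trans (length-≤-∣candidates∣* L ((2 + m ∸ ∣ candidates U v ∣) * pathBound m) second-step paths distinct)
                  (pathBound-step m _ (ℕ.≤-trans (∣-∣-mono-⊆ (candidates-⊆ U v)) U≤2+m))
        where
        second-step : ∀ w → candidates U v w ≡ true → ∀ L′ → All (Path w (U - w) (suc m)) L′ → AllPairs _≢_ L′ →
                      length L′ ≤ (2 + m ∸ ∣ candidates U v ∣) * pathBound m
        second-step w cand L′ paths′ distinct′ =
          ℕ.≤-trans (paths-bound-by-first-step m L′ (∣U-w∣≤ U≤2+m cand) paths′ distinct′)
                    (ℕ.*-monoˡ-≤ (pathBound m) (ℕ.m+n≤o⇒m≤o∸n ∣ candidates (U - w) w ∣ (ℕ.≤-trans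
                      (∣-∣-disjoint (candidates-disjoint cand)
                                    (λ u c → ∧-conicalˡ (U u) _ (candidates-⊆ (U - w) w u c))
                                    (candidates-⊆ U v))
                      U≤2+m)))
      paths-bound-by-first-step m L U≤1+m =
        length-≤-∣candidates∣* L (pathBound m) (λ w cand L′ → paths-bound m L′ (∣U-w∣≤ U≤1+m cand))

  -- Listing a Hamiltonian cycle from vertex 0

  injective⇒surjective : ∀ {n} {f : Fin n → Fin n} → Injective _≡_ _≡_ f → ∀ y → ∃ λ x → f x ≡ y
  injective⇒surjective {suc n} {f} f-injective y with Fin.any? (λ x → f x ≟ y)
  ... | yes hit  = hit
  ... | no  miss = ⊥-elim (ℕ.1+n≰n (Fin.injective⇒≤ punchOut∘f-injective))
    where
    y≢f : ∀ x → y ≢ f x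
    y≢f x y≡fx = miss (x , sym y≡fx)
    punchOut∘f-injective : Injective _≡_ _≡_ (λ x → punchOut (y≢f x))
    punchOut∘f-injective eq = f-injective (Fin.punchOut-injective (y≢f _) (y≢f _) eq)

  module _ {n : ℕ} where

    next : Fin (suc n) → Fin (suc n)
    next i with suc (toℕ i) ℕ.<? suc n
    ... | yes i+1<1+n = fromℕ< i+1<1+n
    ... | no  _       = zero

    next-CycNext : ∀ i → CycNext i (next i)
    next-CycNext i with suc (toℕ i) ℕ.<? suc n
    ... | yes i+1<1+n = inj₁ (Fin.toℕ-fromℕ< i+1<1+n)
    ... | no  i+1≮1+n = inj₂ (ℕ.≤-antisym (ℕ.≤-pred (Fin.toℕ<n i)) (ℕ.≤-pred (ℕ.≮⇒≥ i+1≮1+n)) , refl)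

    CycNext⇒≡next : ∀ {i j} → CycNext i j → j ≡ next i
    CycNext⇒≡next {i} {j} (inj₁ j≡i+1) with suc (toℕ i) ℕ.<? suc n
    ... | yes i+1<1+n = Fin.toℕ-injective (trans j≡i+1 (sym (Fin.toℕ-fromℕ< i+1<1+n)))
    ... | no  i+1≮1+n = ⊥-elim (i+1≮1+n (subst (_< suc n) j≡i+1 (Fin.toℕ<n j)))
    CycNext⇒≡next {i} {j} (inj₂ (i≡n , j≡0)) with suc (toℕ i) ℕ.<? suc n
    ... | yes i+1<1+n = ⊥-elim (ℕ.<-irrefl refl (subst (λ m → suc m < suc n) i≡n i+1<1+n))
    ... | no  _       = Fin.toℕ-injective j≡0

    CycNext-injectiveˡ : ∀ {a b j : Fin (suc n)} → CycNext a j → CycNext b j → a ≡ b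
    CycNext-injectiveˡ (inj₁ j≡a+1)     (inj₁ j≡b+1)     = Fin.toℕ-injective (ℕ.suc-injective (trans (sym j≡a+1) j≡b+1))
    CycNext-injectiveˡ (inj₁ j≡a+1)     (inj₂ (_ , j≡0)) = case trans (sym j≡a+1) j≡0 of λ ()
    CycNext-injectiveˡ (inj₂ (_ , j≡0)) (inj₁ j≡b+1)     = case trans (sym j≡b+1) j≡0 of λ ()
    CycNext-injectiveˡ (inj₂ (a≡n , _)) (inj₂ (b≡n , _)) = Fin.toℕ-injective (trans a≡n (sym b≡n))

    next-injective : Injective _≡_ _≡_ next
    next-injective {a} {b} na≡nb = CycNext-injectiveˡ (next-CycNext a) (subst (CycNext b) (sym na≡nb) (next-CycNext b))

    rotate : ℕ → Fin (suc n) → Fin (suc n)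
    rotate zero    = id
    rotate (suc r) = next ∘ rotate r

    rotate-next : ∀ r i → rotate r (next i) ≡ next (rotate r i)
    rotate-next zero    i = refl
    rotate-next (suc r) i = cong next (rotate-next r i)

    rotate-injective : ∀ r → Injective _≡_ _≡_ (rotate r)
    rotate-injective zero    eq = eq
    rotate-injective (suc r) eq = rotate-injective r (next-injective eq)

    toℕ-rotate-zero : ∀ r → r < suc n → toℕ (rotate r zero) ≡ r
    toℕ-rotate-zero zero    _       = refl
    toℕ-rotate-zero (suc r) r+1<1+n with toℕ-rotate-zero r (ℕ.<-trans (ℕ.n<1+n r) r+1<1+n) | next-CycNext (rotate r zero)
    ... | toℕ≡r | inj₁ next≡+1  = trans next≡+1 (cong suc toℕ≡r)
    ... | toℕ≡r | inj₂ (≡n , _) = ⊥-elim (ℕ.<-irrefl (trans (sym toℕ≡r) ≡n) (ℕ.≤-pred r+1<1+n))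

    CycleEdge-cong : ∀ {σ τ : Fin (suc n) → Fin (suc n)} → (∀ i → σ i ≡ τ i) → ∀ {u v} → CycleEdge σ u v → CycleEdge τ u v
    CycleEdge-cong σ≗τ (i , j , i→j , inj₁ (u≡σi , v≡σj)) = i , j , i→j , inj₁ (trans u≡σi (σ≗τ i) , trans v≡σj (σ≗τ j))
    CycleEdge-cong σ≗τ (i , j , i→j , inj₂ (u≡σj , v≡σi)) = i , j , i→j , inj₂ (trans u≡σj (σ≗τ j) , trans v≡σi (σ≗τ i))

    module _ (σ : Fin (suc n) → Fin (suc n)) (r : ℕ) where

      CycleEdge-rotate⁺ : ∀ {u v} → CycleEdge (σ ∘ rotate r) u v → CycleEdge σ u v
      CycleEdge-rotate⁺ (i , j , i→j , uv) = rotate r i , rotate r j , ρi→ρj , uv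
        where
        ρi→ρj : CycNext (rotate r i) (rotate r j)
        ρi→ρj = subst (CycNext (rotate r i)) (sym (trans (cong (rotate r) (CycNext⇒≡next i→j)) (rotate-next r i)))
                      (next-CycNext (rotate r i))

      CycleEdge-rotate⁻ : ∀ {u v} → CycleEdge σ u v → CycleEdge (σ ∘ rotate r) u v
      CycleEdge-rotate⁻ {u} {v} (i , j , i→j , uv) with i′ , ρi′≡i ← injective⇒surjective (rotate-injective r) i =
        i′ , next i′ , next-CycNext i′ , subst₂ (λ a b → (u ≡ σ a × v ≡ σ b) ⊎ (u ≡ σ b × v ≡ σ a)) (sym ρi′≡i) (sym ρ[i′+1]≡j) uv
        where
        ρ[i′+1]≡j : rotate r (next i′) ≡ j
        ρ[i′+1]≡j = trans (rotate-next r i′) (trans (cong next ρi′≡i) (sym (CycNext⇒≡next i→j)))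

  record RootedOrdering {n : ℕ} (C : EdgeSet (suc n)) : Set where
    field
      vertexAt           : Fin (suc n) → Fin (suc n)
      vertexAt-zero      : vertexAt zero ≡ zero
      vertexAt-injective : Injective _≡_ _≡_ vertexAt
      edge⇒CycleEdge     : ∀ {u v} → C u v ≡ true → CycleEdge vertexAt u v
      CycleEdge⇒edge     : ∀ {u v} → CycleEdge vertexAt u v → C u v ≡ true

  open RootedOrdering

  hamCycle-rooted : ∀ {n} (H : Graph (suc n)) {C} → HamCycle H C → RootedOrdering C
  hamCycle-rooted H (_ , _ , σ , σ-injective , edges) = record
    { vertexAt           = σ ∘ rotate r
    ; vertexAt-zero      = trans (cong σ (Fin.toℕ-injective (toℕ-rotate-zero r (Fin.toℕ<n i₀)))) σi₀≡0
    ; vertexAt-injective = rotate-injective r ∘ σ-injective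
    ; edge⇒CycleEdge     = λ {u} {v} uv → CycleEdge-rotate⁻ σ r (proj₁ (edges u v) uv)
    ; CycleEdge⇒edge     = λ {u} {v} cyc → proj₂ (edges u v) (CycleEdge-rotate⁺ σ r cyc)
    }
    where
    i₀ = proj₁ (injective⇒surjective σ-injective zero)
    σi₀≡0 = proj₂ (injective⇒surjective σ-injective zero)
    r = toℕ i₀

  tabulate-injective : ∀ {A : Set} {m} {f g : Fin m → A} → tabulate f ≡ tabulate g → ∀ i → f i ≡ g i
  tabulate-injective {m = suc m} eq zero    = proj₁ (List.∷-injective eq)
  tabulate-injective {m = suc m} eq (suc i) = tabulate-injective (proj₂ (List.∷-injective eq)) i

  module _ {A B : Set} {P : A → Set} (f : ∀ {x} → P x → B) where

    length-reduce : ∀ {xs} (ps : All P xs) → length (reduce f ps) ≡ length xs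
    length-reduce []       = refl
    length-reduce (_ ∷ ps) = cong suc (length-reduce ps)

    All-reduce : ∀ {Q : B → Set} → (∀ {x} (p : P x) → Q (f p)) → ∀ {xs} (ps : All P xs) → All Q (reduce f ps)
    All-reduce Qf []       = []
    All-reduce Qf (p ∷ ps) = Qf p ∷ All-reduce Qf ps

    module _ {R : A → A → Set} {S : B → B → Set} (R⇒S : ∀ {x y} (p : P x) (q : P y) → R x y → S (f p) (f q)) where

      private
        All-reduce-R⇒S : ∀ {x} (p : P x) {ys} (qs : All P ys) → All (R x) ys → All (S (f p)) (reduce f qs)
        All-reduce-R⇒S p []       []           = []
        All-reduce-R⇒S p (q ∷ qs) (Rxy ∷ Rxys) = R⇒S p q Rxy ∷ All-reduce-R⇒S p qs Rxys

      AllPairs-reduce : ∀ {xs} (ps : All P xs) → AllPairs R xs → AllPairs S (reduce f ps)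
      AllPairs-reduce []       []            = []
      AllPairs-reduce (p ∷ ps) (Rxs ∷ Rxss) = All-reduce-R⇒S p ps Rxs ∷ AllPairs-reduce ps Rxss

  module _ {n : ℕ} (H : Graph (suc n)) where

    cyclePath : ∀ {C} → RootedOrdering C → List (Fin (suc n))
    cyclePath R = tabulate (vertexAt R ∘ suc)

    cyclePath-Path : ∀ {C} → (∀ u v → C u v ≡ true → adj H u v ≡ true) → (R : RootedOrdering C) →
                     Path H zero (allVertices - zero) n (cyclePath R)
    cyclePath-Path C⊆H R = subst (λ v → Path H v (allVertices - zero) n (cyclePath R)) (vertexAt-zero R)
      (tabulate-Path H (vertexAt R) (λ eq → Fin.suc-injective (vertexAt-injective R eq)) nonzero adjacent)
      where
      nonzero : ∀ i → (allVertices - zero) (vertexAt R (suc i)) ≡ true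
      nonzero i with vertexAt R (suc i) ≟ zero
      ... | yes τ₁₊ᵢ≡0 = case vertexAt-injective R (trans τ₁₊ᵢ≡0 (sym (vertexAt-zero R))) of λ ()
      ... | no  _      = refl
      adjacent : ∀ i → adj H (vertexAt R (inject₁ i)) (vertexAt R (suc i)) ≡ true
      adjacent i = C⊆H _ _ (CycleEdge⇒edge R (inject₁ i , suc i , inj₁ (cong suc (sym (Fin.toℕ-inject₁ i))) , inj₁ (refl , refl)))

    cyclePath-injective : ∀ {C D} (R : RootedOrdering C) (R′ : RootedOrdering D) → cyclePath R ≡ cyclePath R′ →
                          ∀ u v → C u v ≡ D u v
    cyclePath-injective R R′ eq u v = ⇔→≡ {z = true} (mk⇔
      (λ Cuv → CycleEdge⇒edge R′ (CycleEdge-cong τ≗τ′ (edge⇒CycleEdge R Cuv)))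
      (λ Duv → CycleEdge⇒edge R (CycleEdge-cong (sym ∘ τ≗τ′) (edge⇒CycleEdge R′ Duv))))
      where
      τ≗τ′ : ∀ i → vertexAt R i ≡ vertexAt R′ i
      τ≗τ′ zero    = trans (vertexAt-zero R) (sym (vertexAt-zero R′))
      τ≗τ′ (suc i) = tabulate-injective eq i

    hamCycles-bound : TriangleFree H → ∀ L → All (HamCycle H) L → AllPairs DistinctES L → length L ≤ pathBound n
    hamCycles-bound triangleFree L hcs distinct = begin
      length L                  ≡⟨ length-reduce {P = HamCycle H} path hcs ⟨
      length (reduce path hcs)  ≤⟨ paths-bound H triangleFree n (reduce path hcs) ∣V-0∣≤n
                                     (All-reduce {P = HamCycle H} path (λ hc → cyclePath-Path (proj₁ (proj₂ hc)) (hamCycle-rooted H hc)) hcs)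
                                     (AllPairs-reduce {P = HamCycle H} path path-distinct hcs distinct) ⟩
      pathBound n               ∎
      where
      open ℕ.≤-Reasoning
      path : ∀ {C} → HamCycle H C → List (Fin (suc n))
      path hc = cyclePath (hamCycle-rooted H hc)
      path-distinct : ∀ {C D} (hc : HamCycle H C) (hd : HamCycle H D) → DistinctES C D → path hc ≢ path hd
      path-distinct hc hd (u , v , Cuv≢Duv) eq = Cuv≢Duv (cyclePath-injective (hamCycle-rooted H hc) (hamCycle-rooted H hd) eq u v)
      ∣V-0∣≤n : ∣ allVertices {suc n} - zero ∣ ≤ n
      ∣V-0∣≤n = ℕ.≤-reflexive (ℕ.suc-injective (trans (∣-∣-remove {suc n} allVertices {zero} refl) (∣allVertices∣≡n (suc n))))

open import Data.Nat using (ℕ; zero; suc; _!)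
import Data.Nat as ℕ
import Data.Nat.Properties as ℕ
open import Data.List using (List; []; _∷_; length)
open import Data.List.Relation.Unary.All using (All; _∷_)
open import Data.List.Relation.Unary.AllPairs using (AllPairs)
open import Data.Rational using (_≤_; _*_)
import Data.Rational.Properties as ℚ
open import Data.Product.Base using (∃; _,_)
open import Data.Sum.Base using (_⊎_; inj₁; inj₂)
open import Relation.Binary.PropositionalEquality
open Analysis
open Counting using (pathBound; hamCycles-bound)

even⊎odd : ∀ n → (∃ λ m → n ≡ m ℕ.+ m) ⊎ (∃ λ m → n ≡ suc (m ℕ.+ m))
even⊎odd zero    = inj₁ (0 , refl)
even⊎odd (suc n) with even⊎odd n
... | inj₁ (m , refl) = inj₂ (m , refl)
... | inj₂ (m , refl) = inj₁ (suc m , cong suc (sym (ℕ.+-suc m m)))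

pathBound-≤ : ∀ n k ℓ → 2 ℕ.≤ k → ℓ ℕ.≤ pathBound k →
              ℕ→ℚ ℓ * ℕ→ℚ (2 ℕ.^ suc k) * eSum n ^ℚ suc k ≤ ℕ→ℚ (suc k ℕ.^ suc k) * eSum n ^ℚ 2
pathBound-≤ n k ℓ 2≤k ℓ≤bound = ℚ.≤-trans
  (*-monoʳ-≤ (eSum n ^ℚ suc k) (^ℚ-nonNeg (suc k) (eSum-nonNeg n))
    (*-monoʳ-≤ (ℕ→ℚ (2 ℕ.^ suc k)) (ℕ→ℚ-nonNeg (2 ℕ.^ suc k)) (ℕ→ℚ-mono-≤ ℓ≤bound)))
  (by-parity (even⊎odd k) 2≤k)
  where
  Goal : ℕ → ℕ → Set
  Goal b K = ℕ→ℚ b * ℕ→ℚ (2 ℕ.^ K) * eSum n ^ℚ K ≤ ℕ→ℚ (K ℕ.^ K) * eSum n ^ℚ 2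
  by-parity : ∀ {k} → (∃ λ m → k ≡ m ℕ.+ m) ⊎ (∃ λ m → k ≡ suc (m ℕ.+ m)) → 2 ℕ.≤ k → Goal (pathBound k) (suc k)
  by-parity (inj₁ (zero , refl))  ()
  by-parity (inj₁ (suc m , refl)) _ =
    subst (λ b → Goal b (suc (suc m ℕ.+ suc m))) (cong₂ (λ a b → a ! ℕ.* b !) (ℕ.n≡⌈n+n/2⌉ (suc m)) (ℕ.n≡⌊n+n/2⌋ (suc m)))
      (odd-order-bound n m)
  by-parity (inj₂ (m , refl))     _ =
    subst₂ Goal (cong₂ (λ a b → suc a ! ℕ.* b !) (ℕ.n≡⌊n+n/2⌋ m) (ℕ.n≡⌈n+n/2⌉ m)) (cong suc (ℕ.+-suc m m))
      (even-order-bound n m)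

lemma9 : (k : ℕ) (H : Graph k) → TriangleFree H →
    (L : List (EdgeSet k)) → All (HamCycle H) L → AllPairs DistinctES L →
    (n : ℕ) →
    ℕ→ℚ (length L) * ℕ→ℚ (2 Data.Nat.^ k) * (eSum n ^ℚ k)
    ≤ ℕ→ℚ (k Data.Nat.^ k) * (eSum n ^ℚ 2)
lemma9 k       H triangleFree []      _                         _        n =
  ℚ.≤-trans (ℚ.≤-reflexive (trans (cong (_* eSum n ^ℚ k) (ℚ.*-zeroˡ (ℕ→ℚ (2 ℕ.^ k)))) (ℚ.*-zeroˡ (eSum n ^ℚ k))))
            (*-nonNeg (ℕ→ℚ-nonNeg (k ℕ.^ k)) (^ℚ-nonNeg 2 (eSum-nonNeg n)))
lemma9 zero    H triangleFree (C ∷ L) ((() , _) ∷ _)            _        n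
lemma9 (suc k) H triangleFree (C ∷ L) hcs@((3≤1+k , _) ∷ _)     distinct n =
  pathBound-≤ n k (length (C ∷ L)) (ℕ.≤-pred 3≤1+k) (hamCycles-bound H triangleFree (C ∷ L) hcs distinct)
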